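{- Let $t \geq 5$ be an odd integer and let $J(t)$ be the Flower snark. Then $J(t)$ is odd $2$--factored. Moreover, $J(t)$ is strongly pseudo $2$--factor isomorphic but not $2$--factor isomorphic.
   Context: For odd $t\ge 5$, the Flower snark $J(t)$ has vertex set $\{h_i,u_i,v_i,w_i : i=1,\dots,t\}$ and edge set $\{h_iu_i, h_iv_i, h_iw_i : i=1,\dots,t\} \cup \{u_iu_{i+1}, v_iv_{i+1}, w_iw_{i+1} : i=1,\dots,t-1\} \cup \{u_tv_1, v_tu_1, w_1w_t\}$. A $2$--factor is a spanning $2$--regular subgraph. A graph is odd $2$--factored if every cycle of every $2$--factor has odd length. A graph is $2$--factor isomorphic if it has a $2$--factor and all its $2$--factors are isomorphic. For a $2$--factor $F$ and $i\in\{0,1\}$, let $t_i(F)\in\{0,1\}$ be the parity of the number of cycles of $F$ of length congruent to $2i$ modulo $4$; a graph is strongly pseudo $2$--factor isomorphic if it has a $2$--factor and both $t_0$ and $t_1$ are constant over all its $2$--factors. -}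

module Defs where

open import Data.Nat using (ℕ; zero; suc; _+_; _*_; _%_; _≡ᵇ_; _<ᵇ_)
open import Data.Fin using (Fin; zero; suc; toℕ; remQuot; _≟_)
open import Data.Bool using (Bool; true; false; _∧_; _∨_; not; if_then_else_)
open import Data.Product using (Σ; _×_; _,_; ∃)
open import Relation.Nullary.Decidable using (⌊_⌋)
open import Relation.Binary.PropositionalEquality using (_≡_)
open import Function.Bundles using (_↔_; Inverse)

-- Finite graphs on vertex set Fin n, given by a Bool-valued adjacency
-- relation.  A spanning subgraph is again given by a Bool-valued
-- relation (its edge set).

Rel : ℕ → Set
Rel n = Fin n → Fin n → Bool

count : ∀ {n} → (Fin n → Bool) → ℕ
count {zero}  f = 0
count {suc n} f = (if f zero then 1 else 0) + count (λ i → f (suc i))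

anyF : ∀ {n} → (Fin n → Bool) → Bool
anyF {zero}  f = false
anyF {suc n} f = f zero ∨ anyF (λ i → f (suc i))

_==_ : ∀ {n} → Fin n → Fin n → Bool
x == y = ⌊ x ≟ y ⌋

degree : ∀ {n} → Rel n → Fin n → ℕ
degree F x = count (F x)

IsTwoFactor : ∀ {n} → Rel n → Rel n → Set
IsTwoFactor {n} G F =
  (∀ x y → F x y ≡ F y x) ×
  (∀ x y → F x y ≡ true → G x y ≡ true) ×
  (∀ x → degree F x ≡ 2)

HasTwoFactor : ∀ {n} → Rel n → Set
HasTwoFactor G = ∃ λ F → IsTwoFactor G F

reach : ∀ {n} → Rel n → ℕ → Fin n → Fin n → Bool
reach F zero    x y = x == y
reach F (suc k) x y = reach F k x y ∨ anyF (λ z → reach F k x z ∧ F z y)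

-- x and y lie in the same connected component of F
-- (walks of length ≤ n suffice)
sameComp : ∀ {n} → Rel n → Fin n → Fin n → Bool
sameComp {n} F x y = reach F n x y

-- length (= number of vertices) of the cycle of the 2-factor F through x
cycleLength : ∀ {n} → Rel n → Fin n → ℕ
cycleLength F x = count (sameComp F x)

isRep : ∀ {n} → Rel n → Fin n → Bool
isRep F x = not (anyF (λ y → sameComp F x y ∧ (toℕ y <ᵇ toℕ x)))

numCycles : ∀ {n} → Rel n → (ℕ → Bool) → ℕ
numCycles F P = count (λ x → isRep F x ∧ P (cycleLength F x))

tPar : ∀ {n} → Rel n → ℕ → ℕ
tPar F i = numCycles F (λ L → (L % 4) ≡ᵇ (2 * i)) % 2

OddTwoFactored : ∀ {n} → Rel n → Set
OddTwoFactored G = ∀ F → IsTwoFactor G F → ∀ x → cycleLength F x % 2 ≡ 1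

Isomorphic : ∀ {n} → Rel n → Rel n → Set
Isomorphic {n} F F' =
  Σ (Fin n ↔ Fin n) λ σ → ∀ x y → F x y ≡ F' (Inverse.to σ x) (Inverse.to σ y)

TwoFactorIsomorphic : ∀ {n} → Rel n → Set
TwoFactorIsomorphic G =
  HasTwoFactor G ×
  (∀ F F' → IsTwoFactor G F → IsTwoFactor G F' → Isomorphic F F')

StronglyPseudoTwoFactorIsomorphic : ∀ {n} → Rel n → Set
StronglyPseudoTwoFactorIsomorphic G =
  HasTwoFactor G ×
  (∀ F F' → IsTwoFactor G F → IsTwoFactor G F' →
     (tPar F 0 ≡ tPar F' 0) × (tPar F 1 ≡ tPar F' 1))

-- The Flower snark J(t).  Vertex (a , i) ∈ Fin 4 × Fin t stands for
-- h_{i+1}, u_{i+1}, v_{i+1}, w_{i+1} for a = 0,1,2,3 respectively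
-- (indices shifted to start at 0).

arc : (t : ℕ) → Fin 4 × Fin t → Fin 4 × Fin t → Bool
-- h_i u_i, h_i v_i, h_i w_i
arc t (zero , i) (suc _ , j) = toℕ i ≡ᵇ toℕ j
arc t (zero , i) (zero , j)  = false
-- u_i u_{i+1}, u_t v_1
arc t (suc zero , i) (suc zero , j) = suc (toℕ i) ≡ᵇ toℕ j
arc t (suc zero , i) (suc (suc zero) , j) =
  (suc (toℕ i) ≡ᵇ t) ∧ (toℕ j ≡ᵇ 0)
-- v_i v_{i+1}, v_t u_1
arc t (suc (suc zero) , i) (suc (suc zero) , j) = suc (toℕ i) ≡ᵇ toℕ j
arc t (suc (suc zero) , i) (suc zero , j) =
  (suc (toℕ i) ≡ᵇ t) ∧ (toℕ j ≡ᵇ 0)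
-- w_i w_{i+1}, w_t w_1
arc t (suc (suc (suc zero)) , i) (suc (suc (suc zero)) , j) =
  (suc (toℕ i) ≡ᵇ toℕ j) ∨ ((suc (toℕ i) ≡ᵇ t) ∧ (toℕ j ≡ᵇ 0))
arc t _ _ = false

flowerAdj : (t : ℕ) → Fin 4 × Fin t → Fin 4 × Fin t → Bool
flowerAdj t p q = arc t p q ∨ arc t q p

J : (t : ℕ) → Rel (4 * t)
J t x y = flowerAdj t (remQuot t x) (remQuot t y)

module Submission where

-- Call {h_j, u_j, v_j, w_j} the j-th column of J(t) and let F be a 2-factor.
-- At each column the degree conditions force exactly two of the six rim
-- edges leaving the column (three to the right, three to the left) to be
-- missing from F.  Matching the right edges of column j with the left edges
-- of column j+1 and going once around the odd number t of columns, this
-- forces exactly one missing right and one missing left edge per column.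
-- Inside a column F then consists of a path through h_j (three vertices)
-- and one isolated rim vertex.  An explicit Boolean colouring of the
-- vertices, constant along the edges of F, separates these two pieces, so
-- every cycle of F meets every column in one or three vertices and has odd
-- length t + 2K.  With all cycles odd, t₀ = t₁ = 0 for every 2-factor.
-- Finally two 2-factors are built by deleting edges of J(t): F₁ contains
-- the cycle w_1 … w_t of length t, while every cycle of F₂ meets column 1
-- or column 2 in at least two vertices, so has length > t; hence F₁ ≇ F₂.

open import Defs
open import Data.Nat using (ℕ; zero; suc; _+_; _*_; _∸_; _≤_; _<_; z≤n; s≤s; _≡ᵇ_; _<ᵇ_; _%_; _/_)
open import Data.Nat.Properties hiding (_≟_)
open import Data.Nat.DivMod using ([m+kn]%n≡m%n; _mod_; m<n⇒m%n≡m; n%n≡0; m%n%n≡m%n; [m+n]%n≡m%n; m%n<n; m≡m%n+[m/n]*n; m∣n⇒o%n%m≡o%m)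
open import Data.Nat.Divisibility using (divides)
open import Data.Fin using (Fin; zero; suc; toℕ; _↑ˡ_; _↑ʳ_; combine; remQuot; _≟_)
open import Data.Fin.Patterns using (0F; 1F; 2F; 3F)
import Data.Fin.Properties as FinP
open import Data.Bool using (Bool; true; false; _∧_; _∨_; not; if_then_else_; _xor_; T)
open import Data.Bool.Properties using (not-involutive; ∨-comm; ∧-zeroʳ; ∧-identityʳ; ∧-distribˡ-∨; ∨-identityʳ)
open import Data.Unit using (tt)
open import Data.Product using (_×_; _,_; ∃; proj₁; proj₂)
open import Data.Sum using (_⊎_; inj₁; inj₂; [_,_]′)
open import Data.Empty using (⊥; ⊥-elim)
open import Relation.Nullary using (¬_; yes; no)
open import Relation.Binary.PropositionalEquality hiding (J)
open import Function.Bundles using (_↔_; Inverse)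
import Algebra.Properties.CommutativeMonoid.Sum as CMSum
open import Algebra.Properties.CommutativeSemigroup +-commutativeSemigroup using (interchange; x∙yz≈y∙xz)

∧-elimˡ : ∀ {a b} → (a ∧ b) ≡ true → a ≡ true
∧-elimˡ {true} _ = refl

∧-elimʳ : ∀ {a b} → (a ∧ b) ≡ true → b ≡ true
∧-elimʳ {true} p = p

∧-intro : ∀ {a b} → a ≡ true → b ≡ true → (a ∧ b) ≡ true
∧-intro refl refl = refl

∨-elim : ∀ {a b} → (a ∨ b) ≡ true → a ≡ true ⊎ b ≡ true
∨-elim {true} _ = inj₁ refl
∨-elim {false} p = inj₂ p

∨-introˡ : ∀ {a} b → a ≡ true → (a ∨ b) ≡ true
∨-introˡ b refl = refl

∨-introʳ : ∀ a {b} → b ≡ true → (a ∨ b) ≡ true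
∨-introʳ true _ = refl
∨-introʳ false p = p

_⇒_ : Bool → Bool → Bool
a ⇒ b = not a ∨ b
infixr 0 _⇒_

⇒-elim : ∀ {a b} → (a ⇒ b) ≡ true → a ≡ true → b ≡ true
⇒-elim p refl = p

⇒-intro : ∀ {a b} → (a ≡ true → b ≡ true) → (a ⇒ b) ≡ true
⇒-intro {true} f = f refl
⇒-intro {false} f = refl

true-iff⇒≡ : ∀ {a b} → (a ≡ true → b ≡ true) → (b ≡ true → a ≡ true) → a ≡ b
true-iff⇒≡ {true} f g = sym (f refl)
true-iff⇒≡ {false} {true} f g = g refl
true-iff⇒≡ {false} {false} f g = refl

not-true⇒false : ∀ {b} → ¬ (b ≡ true) → b ≡ false
not-true⇒false {true} f = ⊥-elim (f refl)
not-true⇒false {false} f = refl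

bool-cases : (b : Bool) → b ≡ true ⊎ b ≡ false
bool-cases true = inj₁ refl
bool-cases false = inj₂ refl

≡ᵇ-true⇒≡ : ∀ {m k} → (m ≡ᵇ k) ≡ true → m ≡ k
≡ᵇ-true⇒≡ {m} {k} p = ≡ᵇ⇒≡ m k (subst T (sym p) tt)

≡⇒≡ᵇ-true : ∀ {m k} → m ≡ k → (m ≡ᵇ k) ≡ true
≡⇒≡ᵇ-true {m} {k} p with m ≡ᵇ k in e
... | true = refl
... | false = ⊥-elim (subst T e (≡⇒≡ᵇ m k p))

≢⇒≡ᵇ-false : ∀ {m k} → m ≢ k → (m ≡ᵇ k) ≡ false
≢⇒≡ᵇ-false {m} {k} ne with m ≡ᵇ k in e
... | false = refl
... | true = ⊥-elim (ne (≡ᵇ-true⇒≡ e))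

⟦_⟧ : Bool → ℕ
⟦ b ⟧ = if b then 1 else 0

-- Exhaustive verification of Boolean functions of k arguments: `allTrue`
-- evaluates on all 2^k inputs, and `allTrue-sound` turns a successful
-- evaluation into a proof for every input.
BoolFn : ℕ → Set
BoolFn zero = Bool
BoolFn (suc k) = Bool → BoolFn k

allTrue : ∀ k → BoolFn k → Bool
allTrue zero b = b
allTrue (suc k) f = allTrue k (f true) ∧ allTrue k (f false)

Valid : ∀ k → BoolFn k → Set
Valid zero b = b ≡ true
Valid (suc k) f = ∀ b → Valid k (f b)

allTrue-sound : ∀ k f → allTrue k f ≡ true → Valid k f
allTrue-sound zero f p = p
allTrue-sound (suc k) f p true = allTrue-sound k (f true) (∧-elimˡ p)
allTrue-sound (suc k) f p false = allTrue-sound k (f false) (∧-elimʳ {allTrue k (f true)} p)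

==-refl : ∀ {n} (a : Fin n) → (a == a) ≡ true
==-refl a with a ≟ a
... | yes _ = refl
... | no ne = ⊥-elim (ne refl)

==⇒≡ : ∀ {n} {a b : Fin n} → (a == b) ≡ true → a ≡ b
==⇒≡ {a = a} {b} p with a ≟ b
... | yes e = e

≢⇒==-false : ∀ {n} {a b : Fin n} → a ≢ b → (a == b) ≡ false
≢⇒==-false {a = a} {b} ne with a ≟ b
... | yes e = ⊥-elim (ne e)
... | no _ = refl

count-ext : ∀ {n} {f g : Fin n → Bool} → (∀ i → f i ≡ g i) → count f ≡ count g
count-ext {zero} e = refl
count-ext {suc n} {f} {g} e = cong₂ _+_ (cong ⟦_⟧ (e zero)) (count-ext (λ i → e (suc i)))

count≤n : ∀ {n} (f : Fin n → Bool) → count f ≤ n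
count≤n {zero} f = z≤n
count≤n {suc n} f with f zero
... | true = s≤s (count≤n (λ i → f (suc i)))
... | false = m≤n⇒m≤1+n (count≤n (λ i → f (suc i)))

count-mono : ∀ {n} {f g : Fin n → Bool} → (∀ i → f i ≡ true → g i ≡ true) → count f ≤ count g
count-mono {zero} h = z≤n
count-mono {suc n} {f} {g} h with f zero in ef | g zero in eg
... | true | true = s≤s (count-mono (λ i → h (suc i)))
... | false | true = m≤n⇒m≤1+n (count-mono (λ i → h (suc i)))
... | false | false = count-mono (λ i → h (suc i))
... | true | false with () ← trans (sym (h zero ef)) eg

count-strict : ∀ {n} {f g : Fin n → Bool} → (∀ i → f i ≡ true → g i ≡ true) →
  ∀ j → g j ≡ true → f j ≡ false → count f < count g
count-strict {suc n} {f} {g} h zero gj fj rewrite gj | fj = s≤s (count-mono (λ i → h (suc i)))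
count-strict {suc n} {f} {g} h (suc j) gj fj with f zero in ef | g zero in eg
... | true | true = s≤s (count-strict (λ i → h (suc i)) j gj fj)
... | false | true = m≤n⇒m≤1+n (count-strict (λ i → h (suc i)) j gj fj)
... | false | false = count-strict (λ i → h (suc i)) j gj fj
... | true | false with () ← trans (sym (h zero ef)) eg

count-∨-disjoint : ∀ {n} (f g : Fin n → Bool) → (∀ i → (f i ∧ g i) ≡ false) →
  count (λ i → f i ∨ g i) ≡ count f + count g
count-∨-disjoint {zero} f g d = refl
count-∨-disjoint {suc n} f g d with f zero in ef | g zero in eg | d zero
... | true | true | ()
... | true | false | _ = cong suc (count-∨-disjoint _ _ (λ i → d (suc i)))
... | false | true | _ = trans (cong suc (count-∨-disjoint _ _ (λ i → d (suc i)))) (sym (+-suc _ _))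
... | false | false | _ = count-∨-disjoint _ _ (λ i → d (suc i))

count-none : ∀ {n} (f : Fin n → Bool) → (∀ i → f i ≡ false) → count f ≡ 0
count-none {zero} f h = refl
count-none {suc n} f h rewrite h zero = count-none _ (λ i → h (suc i))

count-pos : ∀ {n} (f : Fin n → Bool) i → f i ≡ true → 1 ≤ count f
count-pos {n} f i p = subst (λ z → z < count f) (count-none {n} (λ _ → false) (λ _ → refl))
  (count-strict {n} {λ _ → false} (λ _ ()) i p refl)

count-singleton : ∀ {n} (a : Fin n) (b : Bool) → count (λ i → (i == a) ∧ b) ≡ ⟦ b ⟧
count-singleton {suc n} zero b =
  trans (cong (⟦ b ⟧ +_) (count-none {n} (λ i → (suc i == zero) ∧ b) (λ i → refl))) (+-identityʳ _)
count-singleton {suc n} (suc a) b =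
  trans (count-ext (λ i → cong (_∧ b) (suc==suc i a))) (count-singleton a b)
  where
  suc==suc : ∀ {n} (i a : Fin n) → (suc i == suc a) ≡ (i == a)
  suc==suc i a = true-iff⇒≡
    (λ p → subst (λ z → (i == z) ≡ true) (FinP.suc-injective (==⇒≡ p)) (==-refl i))
    (λ p → subst (λ z → (suc i == suc z) ≡ true) (==⇒≡ p) (==-refl (suc i)))

count-on-three : ∀ {n} (f : Fin n → Bool) (a b c : Fin n) → a ≢ b → a ≢ c → b ≢ c →
  (∀ y → f y ≡ true → y ≡ a ⊎ y ≡ b ⊎ y ≡ c) →
  count f ≡ ⟦ f a ⟧ + (⟦ f b ⟧ + ⟦ f c ⟧)
count-on-three f a b c a≢b a≢c b≢c support =
  trans (count-ext pointwise)
  (trans (count-∨-disjoint _ _ disjoint-a)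
  (cong₂ _+_ (count-singleton a (f a))
    (trans (count-∨-disjoint _ _ disjoint-bc) (cong₂ _+_ (count-singleton b (f b)) (count-singleton c (f c))))))
  where
  at : Fin _ → Fin _ → Bool
  at i z = (i == z) ∧ f z

  at-false : ∀ y z → f y ≡ false → at y z ≡ false
  at-false y z fy with y ≟ z
  ... | yes refl = fy
  ... | no _ = refl

  pointwise : ∀ y → f y ≡ at y a ∨ (at y b ∨ at y c)
  pointwise y with f y in fy
  ... | true with support y fy
  ... | inj₁ refl = sym (∨-introˡ _ (∧-intro (==-refl a) fy))
  ... | inj₂ (inj₁ refl) = sym (∨-introʳ (at y a) (∨-introˡ _ (∧-intro (==-refl b) fy)))
  pointwise y | true | inj₂ (inj₂ refl) = sym (∨-introʳ (at y a) (∨-introʳ (at y b) (∧-intro (==-refl c) fy)))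
  pointwise y | false rewrite at-false y a fy | at-false y b fy | at-false y c fy = refl

  apart : ∀ i z w → z ≢ w → (at i z ∧ at i w) ≡ false
  apart i z w ne with i ≟ z | i ≟ w
  ... | yes refl | yes refl = ⊥-elim (ne refl)
  ... | yes refl | no _ = ∧-zeroʳ (f z)
  ... | no _ | _ = refl

  disjoint-a : ∀ i → (at i a ∧ (at i b ∨ at i c)) ≡ false
  disjoint-a i rewrite ∧-distribˡ-∨ (at i a) (at i b) (at i c) | apart i a b a≢b | apart i a c a≢c = refl

  disjoint-bc : ∀ i → (at i b ∧ at i c) ≡ false
  disjoint-bc i = apart i b c b≢c

anyF-intro : ∀ {n} (f : Fin n → Bool) i → f i ≡ true → anyF f ≡ true
anyF-intro f zero p rewrite p = refl
anyF-intro f (suc i) p = ∨-introʳ (f zero) (anyF-intro (λ j → f (suc j)) i p)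

anyF-elim : ∀ {n} (f : Fin n → Bool) → anyF f ≡ true → ∃ λ i → f i ≡ true
anyF-elim {zero} f ()
anyF-elim {suc n} f p with f zero in e
... | true = zero , e
... | false with anyF-elim (λ j → f (suc j)) p
... | i , q = suc i , q

anyF-ext : ∀ {n} {f g : Fin n → Bool} → (∀ i → f i ≡ g i) → anyF f ≡ anyF g
anyF-ext {zero} e = refl
anyF-ext {suc n} e = cong₂ _∨_ (e zero) (anyF-ext (λ i → e (suc i)))

anyF-false : ∀ {n} (f : Fin n → Bool) → anyF f ≡ false → ∀ i → f i ≡ false
anyF-false f p i with f i in e
... | false = refl
... | true with () ← trans (sym (anyF-intro f i e)) p

module Reindex {n : ℕ} (σ : Fin n ↔ Fin n) where
  open Inverse σ

  to-injective : ∀ {x y} → to x ≡ to y → x ≡ y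
  to-injective {x} {y} e = trans (sym (strictlyInverseʳ x)) (trans (cong from e) (strictlyInverseʳ y))

  anyF-perm : (g : Fin n → Bool) → anyF g ≡ anyF (λ i → g (to i))
  anyF-perm g = true-iff⇒≡
    (λ p → let (i , q) = anyF-elim g p in
      anyF-intro (λ i → g (to i)) (from i) (trans (cong g (strictlyInverseˡ i)) q))
    (λ p → let (i , q) = anyF-elim _ p in anyF-intro g (to i) q)

  -- `count` agrees with the library sum of indicators, whose invariance
  -- under permutations is `sum-permute`.
  count≡sum : ∀ {m} (f : Fin m → Bool) → count f ≡ CMSum.sum +-0-commutativeMonoid (λ i → ⟦ f i ⟧)
  count≡sum {zero} f = refl
  count≡sum {suc m} f = cong (⟦ f zero ⟧ +_) (count≡sum (λ i → f (suc i)))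

  count-perm : (f : Fin n → Bool) → count f ≡ count (λ i → f (to i))
  count-perm f = trans (count≡sum f) (trans (CMSum.sum-permute +-0-commutativeMonoid (λ i → ⟦ f i ⟧) σ)
    (sym (count≡sum (λ i → f (to i)))))

-- (2) Connected components of a finite relation

-- The sets `within k` increase
-- with k and stabilise once they stop growing; since they have at most N
-- elements, they are stable from k = N on.
module Component {N : ℕ} (F : Rel N) (x : Fin N) where
  within : ℕ → Fin N → Bool
  within k = reach F k x

  within-mono : ∀ k y → within k y ≡ true → within (suc k) y ≡ true
  within-mono k y p = ∨-introˡ _ p

  within-step : ∀ k z y → within k z ≡ true → F z y ≡ true → within (suc k) y ≡ true
  within-step k z y p q = ∨-introʳ (within k y) (anyF-intro (λ w → within k w ∧ F w y) z (∧-intro p q))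

  Stable : ℕ → Set
  Stable k = ∀ y → within (suc k) y ≡ within k y

  stable-suc : ∀ k → Stable k → Stable (suc k)
  stable-suc k st y = cong₂ _∨_ (st y) (anyF-ext (λ w → cong (_∧ F w y) (st w)))

  stable-or-grows : ∀ k → Stable k ⊎ (∃ λ y → within (suc k) y ≡ true × within k y ≡ false)
  stable-or-grows k with anyF (λ y → within (suc k) y ∧ not (within k y)) in e
  ... | true with anyF-elim _ e
  ... | y , q = inj₂ (y , ∧-elimˡ q , trans (sym (not-involutive _)) (cong not (∧-elimʳ {within (suc k) y} q)))
  stable-or-grows k | false = inj₁ λ y → unchanged y (anyF-false _ e y)
    where
    unchanged : ∀ y → (within (suc k) y ∧ not (within k y)) ≡ false → within (suc k) y ≡ within k y
    unchanged y p with within k y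
    ... | true = refl
    ... | false = trans (sym (∧-identityʳ _)) p

  grows-or-stable : ∀ k → suc k ≤ count (within k) ⊎ Stable k
  grows-or-stable zero = inj₁ (count-pos (within 0) x (==-refl x))
  grows-or-stable (suc k) with grows-or-stable k
  ... | inj₂ st = inj₂ (stable-suc k st)
  ... | inj₁ c with stable-or-grows k
  ... | inj₁ st = inj₂ (stable-suc k st)
  ... | inj₂ (y , p , q) = inj₁ (≤-trans (s≤s c) (count-strict (within-mono k) y p q))

  stable-at-N : Stable N
  stable-at-N with grows-or-stable N
  ... | inj₂ st = st
  ... | inj₁ c = ⊥-elim (<-irrefl refl (≤-trans c (count≤n (within N))))

  comp-closed : ∀ y z → sameComp F x y ≡ true → F y z ≡ true → sameComp F x z ≡ true
  comp-closed y z p q = trans (sym (stable-at-N z)) (within-step N y z p q)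

  comp-refl : sameComp F x x ≡ true
  comp-refl = go N
    where go : ∀ k → within k x ≡ true
          go zero = ==-refl x
          go (suc k) = within-mono k x (go k)

  comp-induction : (P : Fin N → Set) → P x → (∀ y z → P y → F y z ≡ true → P z) →
    ∀ y → sameComp F x y ≡ true → P y
  comp-induction P px closed = go N
    where
    go : ∀ k y → within k y ≡ true → P y
    go zero y p = subst P (==⇒≡ p) px
    go (suc k) y p with ∨-elim {within k y} p
    ... | inj₁ q = go k y q
    ... | inj₂ q with anyF-elim _ q
    ... | z , r = closed z y (go k z (∧-elimˡ r)) (∧-elimʳ {within k z} r)

-- An isomorphism σ : F ≅ F' maps walks to walks, hence components to
-- components, so it preserves the length of the cycle through each vertex.
module _ {N : ℕ} (σ : Fin N ↔ Fin N) (F F' : Rel N)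
         (iso : ∀ y z → F y z ≡ F' (Inverse.to σ y) (Inverse.to σ z)) where
  open Inverse σ using (to)
  open Reindex σ

  reach-iso : ∀ k x y → reach F k x y ≡ reach F' k (to x) (to y)
  reach-iso zero x y = true-iff⇒≡
    (λ p → subst (λ z → (to x == to z) ≡ true) (==⇒≡ p) (==-refl _))
    (λ p → subst (λ z → (x == z) ≡ true) (to-injective (==⇒≡ p)) (==-refl _))
  reach-iso (suc k) x y =
    cong₂ _∨_ (reach-iso k x y)
      (trans (anyF-ext (λ w → cong₂ _∧_ (reach-iso k x w) (iso w y)))
        (sym (anyF-perm (λ w → reach F' k (to x) w ∧ F' w (to y)))))

  cycleLength-iso : ∀ x → cycleLength F x ≡ cycleLength F' (to x)
  cycleLength-iso x = trans (count-ext (λ y → reach-iso N x y))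
    (sym (count-perm (λ z → sameComp F' (to x) z)))

sumBelow : (ℕ → ℕ) → ℕ → ℕ
sumBelow g zero = 0
sumBelow g (suc n) = g 0 + sumBelow (λ j → g (suc j)) n

sumBelow-+ : ∀ n (g h : ℕ → ℕ) → sumBelow (λ j → g j + h j) n ≡ sumBelow g n + sumBelow h n
sumBelow-+ zero g h = refl
sumBelow-+ (suc n) g h rewrite sumBelow-+ n (λ j → g (suc j)) (λ j → h (suc j)) =
  interchange (g 0) (h 0) (sumBelow (λ j → g (suc j)) n) (sumBelow (λ j → h (suc j)) n)

sumBelow-odd-terms : ∀ n (g : ℕ → ℕ) → (∀ j → j < n → g j ≡ 1 ⊎ g j ≡ 3) → ∃ λ K → sumBelow g n ≡ n + K * 2
sumBelow-odd-terms zero g h = 0 , refl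
sumBelow-odd-terms (suc n) g h
  with sumBelow-odd-terms n (λ j → g (suc j)) (λ j p → h (suc j) (s≤s p)) | h 0 (s≤s z≤n)
... | K , e | inj₁ g0 rewrite e | g0 = K , refl
... | K , e | inj₂ g0 rewrite e | g0 =
  suc K , cong suc (sym (trans (+-suc n (suc (K * 2))) (cong suc (+-suc n (K * 2)))))

sumBelow-≥ : ∀ n (g : ℕ → ℕ) → (∀ j → j < n → 1 ≤ g j) → n ≤ sumBelow g n
sumBelow-≥ zero g h = z≤n
sumBelow-≥ (suc n) g h = +-mono-≤ (h 0 (s≤s z≤n)) (sumBelow-≥ n (λ j → g (suc j)) (λ j p → h (suc j) (s≤s p)))

sumBelow-> : ∀ n (g : ℕ → ℕ) → (∀ j → j < n → 1 ≤ g j) → ∀ k → k < n → 2 ≤ g k → n < sumBelow g n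
sumBelow-> (suc n) g h zero p q = +-mono-≤ q (sumBelow-≥ n (λ j → g (suc j)) (λ j p → h (suc j) (s≤s p)))
sumBelow-> (suc n) g h (suc k) (s≤s p) q =
  +-mono-≤ (h 0 (s≤s z≤n)) (sumBelow-> n (λ j → g (suc j)) (λ j p → h (suc j) (s≤s p)) k p q)

sumBelow-ones : ∀ n (g : ℕ → ℕ) → (∀ j → j < n → g j ≡ 1) → sumBelow g n ≡ n
sumBelow-ones zero g h = refl
sumBelow-ones (suc n) g h rewrite h 0 (s≤s z≤n) =
  cong suc (sumBelow-ones n (λ j → g (suc j)) (λ j p → h (suc j) (s≤s p)))

count-↑ : ∀ k m (f : Fin (k + m) → Bool) → count f ≡ count (λ i → f (i ↑ˡ m)) + count (λ i → f (k ↑ʳ i))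
count-↑ zero m f = refl
count-↑ (suc k) m f = trans (cong (⟦ f zero ⟧ +_) (count-↑ k m (λ i → f (suc i))))
  (sym (+-assoc ⟦ f zero ⟧ _ _))

sumFin : ∀ {m} → (Fin m → ℕ) → ℕ
sumFin {zero} g = 0
sumFin {suc m} g = g zero + sumFin (λ a → g (suc a))

count-combine : ∀ m k (f : Fin (m * k) → Bool) → count f ≡ sumFin {m} (λ a → count (λ j → f (combine a j)))
count-combine zero k f = refl
count-combine (suc m) k f = trans (count-↑ k (m * k) f)
  (cong (count {k} (λ j → f (combine {suc m} {k} zero j)) +_) (count-combine m k (λ i → f (k ↑ʳ i))))

count-toℕ : ∀ {k} (g : Fin k → Bool) (h : ℕ → Bool) → (∀ i → g i ≡ h (toℕ i)) → count g ≡ sumBelow (λ j → ⟦ h j ⟧) k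
count-toℕ {zero} g h e = refl
count-toℕ {suc k} g h e =
  cong₂ _+_ (cong ⟦_⟧ (e zero)) (count-toℕ (λ i → g (suc i)) (λ j → h (suc j)) (λ i → e (suc i)))

-- (4) Column configurations

-- Layers are indexed by Fin 4: 0 = hubs h, 1 = u, 2 = v, 3 = w.
-- In column j of J(t) a 2-factor F is described by nine Booleans:
-- s₁ s₂ s₃ (spokes h_j u_j, h_j v_j, h_j w_j in F), r₁ r₂ r₃ (rim edges from
-- u_j, v_j, w_j to the right in F) and l₁ l₂ l₃ (rim edges to the left in
-- F); further p is the parity of j and z says j = 0.  The facts below are
-- finite statements about these Booleans and are checked by evaluation.

exactlyTwo : Bool → Bool → Bool → Bool
exactlyTwo a b c = (a ∧ b ∧ not c) ∨ (a ∧ not b ∧ c) ∨ (not a ∧ b ∧ c)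

iffB : Bool → Bool → Bool
iffB x y = not (x xor y)

iffB⇒≡ : ∀ {x y} → iffB x y ≡ true → x ≡ y
iffB⇒≡ {true} {true} _ = refl
iffB⇒≡ {false} {false} _ = refl

≡⇒iffB : ∀ {x y} → x ≡ y → iffB x y ≡ true
≡⇒iffB {true} refl = refl
≡⇒iffB {false} refl = refl

degreesOK : (s₁ s₂ s₃ r₁ r₂ r₃ l₁ l₂ l₃ : Bool) → Bool
degreesOK s₁ s₂ s₃ r₁ r₂ r₃ l₁ l₂ l₃ =
  exactlyTwo s₁ s₂ s₃ ∧ exactlyTwo s₁ r₁ l₁ ∧ exactlyTwo s₂ r₂ l₂ ∧ exactlyTwo s₃ r₃ l₃

missing : Bool → Bool → Bool → ℕ
missing a b c = ⟦ not a ⟧ + (⟦ not b ⟧ + ⟦ not c ⟧)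

missing-balance : Valid 9 (λ s₁ s₂ s₃ r₁ r₂ r₃ l₁ l₂ l₃ →
  degreesOK s₁ s₂ s₃ r₁ r₂ r₃ l₁ l₂ l₃ ⇒ (missing r₁ r₂ r₃ + missing l₁ l₂ l₃ ≡ᵇ 2))
missing-balance = allTrue-sound 9 _ refl

-- The situation established in section (6) for odd t: degrees are 2,
-- exactly one right and one left rim edge is missing, and column 0 is even.
columnOK : (s₁ s₂ s₃ r₁ r₂ r₃ l₁ l₂ l₃ p z : Bool) → Bool
columnOK s₁ s₂ s₃ r₁ r₂ r₃ l₁ l₂ l₃ p z =
  degreesOK s₁ s₂ s₃ r₁ r₂ r₃ l₁ l₂ l₃ ∧ exactlyTwo r₁ r₂ r₃ ∧ exactlyTwo l₁ l₂ l₃ ∧ not (z ∧ p)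

-- Passing from column t - 1 to column 0 the layers u and v are exchanged.
swapUV : Fin 4 → Fin 4
swapUV 1F = 2F
swapUV 2F = 1F
swapUV a = a

swapUV-involutive : ∀ a → swapUV (swapUV a) ≡ a
swapUV-involutive 0F = refl
swapUV-involutive 1F = refl
swapUV-involutive 2F = refl
swapUV-involutive 3F = refl

swapUV-nonhub : ∀ a → a ≢ 0F → swapUV a ≢ 0F
swapUV-nonhub 0F nz = ⊥-elim (nz refl)
swapUV-nonhub 1F nz ()
swapUV-nonhub 2F nz ()
swapUV-nonhub 3F nz ()

-- A rim vertex whose right edge is in F is coloured by the
-- right edge of the cyclically next rim vertex (u → v → w → u), corrected
-- by the parity of the column; otherwise it is coloured in the same way
-- from the left edges, using the parity of the previous column (even for
-- column 0, as t is odd) and the twist u ↔ v between columns t - 1 and 0.  The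
-- hub takes the colour of a spoke neighbour whose right edge is in F.
rimSelect : Fin 4 → Bool → Bool → Bool → Bool
rimSelect 1F a b c = a
rimSelect 2F a b c = b
rimSelect 3F a b c = c
rimSelect _ a b c = false

colourFromRight : Fin 4 → (r₁ r₂ r₃ p : Bool) → Bool
colourFromRight 1F r₁ r₂ r₃ p = r₂ xor p
colourFromRight 2F r₁ r₂ r₃ p = r₃ xor p
colourFromRight 3F r₁ r₂ r₃ p = r₁ xor p
colourFromRight _ r₁ r₂ r₃ p = false

prevParity : (z p : Bool) → Bool
prevParity z p = if z then false else not p

colourFromLeft : Fin 4 → (l₁ l₂ l₃ z q : Bool) → Bool
colourFromLeft 1F l₁ l₂ l₃ z q = (if z then l₃ else l₂) xor q
colourFromLeft 2F l₁ l₂ l₃ z q = (if z then l₁ else l₃) xor q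
colourFromLeft 3F l₁ l₂ l₃ z q = (if z then l₂ else l₁) xor q
colourFromLeft _ l₁ l₂ l₃ z q = false

rimColour : Fin 4 → (r₁ r₂ r₃ l₁ l₂ l₃ p z : Bool) → Bool
rimColour a r₁ r₂ r₃ l₁ l₂ l₃ p z =
  if rimSelect a r₁ r₂ r₃ then colourFromRight a r₁ r₂ r₃ p else colourFromLeft a l₁ l₂ l₃ z (prevParity z p)

hubColour : (s₁ s₂ s₃ r₁ r₂ r₃ p : Bool) → Bool
hubColour s₁ s₂ s₃ r₁ r₂ r₃ p =
  if s₁ ∧ r₁ then colourFromRight 1F r₁ r₂ r₃ p
  else if s₂ ∧ r₂ then colourFromRight 2F r₁ r₂ r₃ p
  else colourFromRight 3F r₁ r₂ r₃ p

spoke-colour : Valid 11 (λ s₁ s₂ s₃ r₁ r₂ r₃ l₁ l₂ l₃ p z → columnOK s₁ s₂ s₃ r₁ r₂ r₃ l₁ l₂ l₃ p z ⇒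
  ((s₁ ⇒ iffB (hubColour s₁ s₂ s₃ r₁ r₂ r₃ p) (rimColour 1F r₁ r₂ r₃ l₁ l₂ l₃ p z)) ∧
   (s₂ ⇒ iffB (hubColour s₁ s₂ s₃ r₁ r₂ r₃ p) (rimColour 2F r₁ r₂ r₃ l₁ l₂ l₃ p z)) ∧
   (s₃ ⇒ iffB (hubColour s₁ s₂ s₃ r₁ r₂ r₃ p) (rimColour 3F r₁ r₂ r₃ l₁ l₂ l₃ p z))))
spoke-colour = allTrue-sound 11 _ refl

two-sided-colour : Valid 11 (λ s₁ s₂ s₃ r₁ r₂ r₃ l₁ l₂ l₃ p z → columnOK s₁ s₂ s₃ r₁ r₂ r₃ l₁ l₂ l₃ p z ⇒
  (((l₁ ∧ r₁) ⇒ iffB (colourFromRight 1F r₁ r₂ r₃ p) (colourFromLeft 1F l₁ l₂ l₃ z (prevParity z p))) ∧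
   ((l₂ ∧ r₂) ⇒ iffB (colourFromRight 2F r₁ r₂ r₃ p) (colourFromLeft 2F l₁ l₂ l₃ z (prevParity z p))) ∧
   ((l₃ ∧ r₃) ⇒ iffB (colourFromRight 3F r₁ r₂ r₃ p) (colourFromLeft 3F l₁ l₂ l₃ z (prevParity z p)))))
two-sided-colour = allTrue-sound 11 _ refl

count4 : Bool → Bool → Bool → Bool → ℕ
count4 a b c d = ⟦ a ⟧ + (⟦ b ⟧ + (⟦ c ⟧ + ⟦ d ⟧))

-- Let c_h c₁ c₂ c₃ describe a nonempty set of vertices
-- of the column that is closed under the spokes of F and monochromatic of
-- colour b (the trace of a cycle of F).  Then it has 1 or 3 elements, and
-- one of its rim vertices has its right edge in F.
column-slice : Valid 16 (λ s₁ s₂ s₃ r₁ r₂ r₃ l₁ l₂ l₃ p z b c_h c₁ c₂ c₃ →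
  (columnOK s₁ s₂ s₃ r₁ r₂ r₃ l₁ l₂ l₃ p z ∧
   (c_h ⇒ iffB (hubColour s₁ s₂ s₃ r₁ r₂ r₃ p) b) ∧
   (c₁ ⇒ iffB (rimColour 1F r₁ r₂ r₃ l₁ l₂ l₃ p z) b) ∧
   (c₂ ⇒ iffB (rimColour 2F r₁ r₂ r₃ l₁ l₂ l₃ p z) b) ∧
   (c₃ ⇒ iffB (rimColour 3F r₁ r₂ r₃ l₁ l₂ l₃ p z) b) ∧
   ((c_h ∧ s₁) ⇒ c₁) ∧ ((c_h ∧ s₂) ⇒ c₂) ∧ ((c_h ∧ s₃) ⇒ c₃) ∧
   ((c₁ ∧ s₁) ⇒ c_h) ∧ ((c₂ ∧ s₂) ⇒ c_h) ∧ ((c₃ ∧ s₃) ⇒ c_h) ∧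
   (c_h ∨ c₁ ∨ c₂ ∨ c₃)) ⇒
  (((count4 c_h c₁ c₂ c₃ ≡ᵇ 1) ∨ (count4 c_h c₁ c₂ c₃ ≡ᵇ 3)) ∧ ((c₁ ∧ r₁) ∨ (c₂ ∧ r₂) ∨ (c₃ ∧ r₃))))
column-slice = allTrue-sound 16 _ refl

-- Reading the colour of the far end of a right edge from the left gives
-- back the colour of the near end: in the gap between columns t - 1 and 0
-- (twisted, the last column being even) ...
colour-across-twisted : ∀ a b l₁ l₂ l₃ z q r₁ r₂ r₃ p → a ≢ 0F → b ≡ swapUV a →
  l₁ ≡ r₂ → l₂ ≡ r₁ → l₃ ≡ r₃ → z ≡ true → p ≡ false →
  colourFromLeft b l₁ l₂ l₃ z (prevParity z q) ≡ colourFromRight a r₁ r₂ r₃ p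
colour-across-twisted 0F _ _ _ _ _ _ _ _ _ _ nz _ _ _ _ _ _ = ⊥-elim (nz refl)
colour-across-twisted 1F _ _ _ _ _ _ _ _ _ _ _ refl refl refl refl refl refl = refl
colour-across-twisted 2F _ _ _ _ _ _ _ _ _ _ _ refl refl refl refl refl refl = refl
colour-across-twisted 3F _ _ _ _ _ _ _ _ _ _ _ refl refl refl refl refl refl = refl

-- ... and in any other gap.
colour-across-inner : ∀ a b l₁ l₂ l₃ z q r₁ r₂ r₃ p → a ≢ 0F → b ≡ a →
  l₁ ≡ r₁ → l₂ ≡ r₂ → l₃ ≡ r₃ → z ≡ false → q ≡ not p →
  colourFromLeft b l₁ l₂ l₃ z (prevParity z q) ≡ colourFromRight a r₁ r₂ r₃ p
colour-across-inner 0F _ _ _ _ _ _ _ _ _ _ nz _ _ _ _ _ _ = ⊥-elim (nz refl)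
colour-across-inner 1F _ _ l₂ _ _ _ _ _ _ p _ refl refl refl refl refl refl = cong (l₂ xor_) (not-involutive p)
colour-across-inner 2F _ _ _ l₃ _ _ _ _ _ p _ refl refl refl refl refl refl = cong (l₃ xor_) (not-involutive p)
colour-across-inner 3F _ l₁ _ _ _ _ _ _ _ p _ refl refl refl refl refl refl = cong (l₁ xor_) (not-involutive p)

2≰1 : ¬ (2 ≤ 1)
2≰1 (s≤s ())

module FlowerSnark (n : ℕ) where
  t : ℕ
  t = suc n

  V : Set
  V = Fin (4 * t)

  vtx : Fin 4 → ℕ → V
  vtx a j = combine a (j mod t)

  layer : V → Fin 4
  layer y = proj₁ (remQuot {4} t y)

  column : V → ℕ
  column y = toℕ (proj₂ (remQuot {4} t y))

  column<t : ∀ y → column y < t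
  column<t y = FinP.toℕ<n (proj₂ (remQuot {4} t y))

  toℕ-mod : ∀ j → toℕ (j mod t) ≡ j % t
  toℕ-mod j = FinP.toℕ-fromℕ< _

  mod-toℕ : (i : Fin t) → toℕ i mod t ≡ i
  mod-toℕ i = FinP.toℕ-injective (trans (toℕ-mod (toℕ i)) (m<n⇒m%n≡m (FinP.toℕ<n i)))

  vtx-coordinates : ∀ y → y ≡ vtx (layer y) (column y)
  vtx-coordinates y = sym (trans (cong (combine (layer y)) (mod-toℕ _)) (FinP.combine-remQuot {4} t y))

  remQuot-vtx : ∀ a j → remQuot {4} t (vtx a j) ≡ (a , j mod t)
  remQuot-vtx a j = FinP.remQuot-combine a (j mod t)

  layer-vtx : ∀ a j → layer (vtx a j) ≡ a
  layer-vtx a j = cong proj₁ (remQuot-vtx a j)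

  column-vtx : ∀ a j → column (vtx a j) ≡ j % t
  column-vtx a j = trans (cong (λ p → toℕ (proj₂ p)) (remQuot-vtx a j)) (toℕ-mod j)

  column-vtx< : ∀ a j → j < t → column (vtx a j) ≡ j
  column-vtx< a j j<t = trans (column-vtx a j) (m<n⇒m%n≡m j<t)

  vtx-cong : ∀ a {i k} → i % t ≡ k % t → vtx a i ≡ vtx a k
  vtx-cong a {i} {k} e = cong (combine a) (FinP.toℕ-injective (trans (toℕ-mod i) (trans e (sym (toℕ-mod k)))))

  vtx-injectiveˡ : ∀ {a b i k} → vtx a i ≡ vtx b k → a ≡ b
  vtx-injectiveˡ {a} {b} {i} {k} e = FinP.combine-injectiveˡ a (i mod t) b (k mod t) e

  vtx-injectiveʳ : ∀ {a b i k} → vtx a i ≡ vtx b k → i % t ≡ k % t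
  vtx-injectiveʳ {a} {b} {i} {k} e =
    trans (sym (toℕ-mod i)) (trans (cong toℕ (FinP.combine-injectiveʳ a (i mod t) b (k mod t) e)) (toℕ-mod k))

  arcℕ : Fin 4 → ℕ → Fin 4 → ℕ → Bool
  arcℕ 0F i (suc _) j = i ≡ᵇ j
  arcℕ 1F i 1F j = suc i ≡ᵇ j
  arcℕ 1F i 2F j = (suc i ≡ᵇ t) ∧ (j ≡ᵇ 0)
  arcℕ 2F i 2F j = suc i ≡ᵇ j
  arcℕ 2F i 1F j = (suc i ≡ᵇ t) ∧ (j ≡ᵇ 0)
  arcℕ 3F i 3F j = (suc i ≡ᵇ j) ∨ ((suc i ≡ᵇ t) ∧ (j ≡ᵇ 0))
  arcℕ _ _ _ _ = false

  arc≡arcℕ : ∀ a (i : Fin t) b (k : Fin t) → arc t (a , i) (b , k) ≡ arcℕ a (toℕ i) b (toℕ k)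
  arc≡arcℕ 0F i 0F k = refl
  arc≡arcℕ 0F i (suc b) k = refl
  arc≡arcℕ 1F i 0F k = refl
  arc≡arcℕ 1F i 1F k = refl
  arc≡arcℕ 1F i 2F k = refl
  arc≡arcℕ 1F i 3F k = refl
  arc≡arcℕ 2F i 0F k = refl
  arc≡arcℕ 2F i 1F k = refl
  arc≡arcℕ 2F i 2F k = refl
  arc≡arcℕ 2F i 3F k = refl
  arc≡arcℕ 3F i 0F k = refl
  arc≡arcℕ 3F i 1F k = refl
  arc≡arcℕ 3F i 2F k = refl
  arc≡arcℕ 3F i 3F k = refl

  adjℕ : Fin 4 → ℕ → Fin 4 → ℕ → Bool
  adjℕ a i b k = arcℕ a i b k ∨ arcℕ b k a i

  J-vtx : ∀ a i b k → J t (vtx a i) (vtx b k) ≡ adjℕ a (i % t) b (k % t)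
  J-vtx a i b k rewrite remQuot-vtx a i | remQuot-vtx b k
    | arc≡arcℕ a (i mod t) b (k mod t) | arc≡arcℕ b (k mod t) a (i mod t) | toℕ-mod i | toℕ-mod k = refl

  J-vtx< : ∀ a j b k → j < t → k < t → J t (vtx a j) (vtx b k) ≡ adjℕ a j b k
  J-vtx< a j b k j<t k<t =
    trans (J-vtx a j b k) (cong₂ (λ x y → adjℕ a x b y) (m<n⇒m%n≡m j<t) (m<n⇒m%n≡m k<t))

  J-sym : ∀ y z → J t y z ≡ J t z y
  J-sym y z = ∨-comm (arc t (remQuot {4} t y) (remQuot {4} t z)) _

  twistR : ℕ → Fin 4 → Fin 4
  twistR j a = if (suc j ≡ᵇ t) then swapUV a else a

  twistL : ℕ → Fin 4 → Fin 4
  twistL j a = if (j ≡ᵇ 0) then swapUV a else a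

  hub : ℕ → V
  hub j = vtx 0F j

  right : Fin 4 → ℕ → V
  right a j = vtx (twistR j a) (suc j)

  left : Fin 4 → ℕ → V
  left a j = vtx (twistL j a) (j + n)

  twistR-last : ∀ j a → (suc j ≡ᵇ t) ≡ true → twistR j a ≡ swapUV a
  twistR-last j a e with j ≡ᵇ n | e
  ... | true | _ = refl

  twistR-inner : ∀ j a → (suc j ≡ᵇ t) ≡ false → twistR j a ≡ a
  twistR-inner j a e with j ≡ᵇ n | e
  ... | false | _ = refl

  twistR-w : ∀ j → twistR j 3F ≡ 3F
  twistR-w j with suc j ≡ᵇ t
  ... | true = refl
  ... | false = refl

  twistL-w : ∀ j → twistL j 3F ≡ 3F
  twistL-w j with j ≡ᵇ 0
  ... | true = refl
  ... | false = refl

  twistL-nonhub : ∀ j a → a ≢ 0F → twistL j a ≢ 0F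
  twistL-nonhub j a nz with j ≡ᵇ 0
  ... | true = swapUV-nonhub a nz
  ... | false = nz

  twistR-nonhub : ∀ j a → a ≢ 0F → twistR j a ≢ 0F
  twistR-nonhub j a nz with j ≡ᵇ n
  ... | true = swapUV-nonhub a nz
  ... | false = nz

  no-wrap : ∀ j k → suc j ≡ k → k < t → (suc j ≡ᵇ t) ≡ false × suc j % t ≡ k
  no-wrap j k refl k<t = ≢⇒≡ᵇ-false (λ e → <-irrefl e k<t) , m<n⇒m%n≡m k<t

  wrap : ∀ j → (suc j ≡ᵇ t) ≡ true → suc j % t ≡ 0
  wrap j e rewrite ≡ᵇ-true⇒≡ {suc j} {t} e = n%n≡0 t

  suc<t : ∀ j → j < t → (suc j ≡ᵇ t) ≡ false → suc j < t
  suc<t j j<t e with m≤n⇒m<n∨m≡n j<t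
  ... | inj₁ p = p
  ... | inj₂ eq with () ← trans (sym (≡⇒≡ᵇ-true eq)) e

  prev-column : ∀ j → suc j < t → (suc j + n) % t ≡ j
  prev-column j sj<t =
    trans (cong (_% t) (sym (+-suc j n))) (trans ([m+n]%n≡m%n j t) (m<n⇒m%n≡m (<-trans (n<1+n j) sj<t)))

  rim-arc : ∀ a b j k → a ≢ 0F → k < t → arcℕ a j b k ≡ true → b ≡ twistR j a × suc j % t ≡ k
  rim-arc 0F b j k nz _ _ = ⊥-elim (nz refl)
  rim-arc 1F 0F j k _ _ ()
  rim-arc 1F 3F j k _ _ ()
  rim-arc 2F 0F j k _ _ ()
  rim-arc 2F 3F j k _ _ ()
  rim-arc 3F 0F j k _ _ ()
  rim-arc 3F 1F j k _ _ ()
  rim-arc 3F 2F j k _ _ ()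
  rim-arc 1F 1F j k _ k<t p with no-wrap j k (≡ᵇ-true⇒≡ p) k<t
  ... | e₁ , e₂ = sym (twistR-inner j 1F e₁) , e₂
  rim-arc 2F 2F j k _ k<t p with no-wrap j k (≡ᵇ-true⇒≡ p) k<t
  ... | e₁ , e₂ = sym (twistR-inner j 2F e₁) , e₂
  rim-arc 1F 2F j k _ k<t p rewrite ≡ᵇ-true⇒≡ {k} {0} (∧-elimʳ {suc j ≡ᵇ t} p) =
    sym (twistR-last j 1F (∧-elimˡ p)) , wrap j (∧-elimˡ p)
  rim-arc 2F 1F j k _ k<t p rewrite ≡ᵇ-true⇒≡ {k} {0} (∧-elimʳ {suc j ≡ᵇ t} p) =
    sym (twistR-last j 2F (∧-elimˡ p)) , wrap j (∧-elimˡ p)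
  rim-arc 3F 3F j k _ k<t p with ∨-elim {suc j ≡ᵇ k} p
  ... | inj₁ q = sym (twistR-w j) , proj₂ (no-wrap j k (≡ᵇ-true⇒≡ q) k<t)
  ... | inj₂ q rewrite ≡ᵇ-true⇒≡ {k} {0} (∧-elimʳ {suc j ≡ᵇ t} q) = sym (twistR-w j) , wrap j (∧-elimˡ q)

  twist-back : ∀ j → j < t → ∀ b → twistL (suc j % t) (twistR j b) ≡ b × ((suc j % t) + n) % t ≡ j
  twist-back j j<t b with suc j ≡ᵇ t in e
  ... | true rewrite wrap j e = swapUV-involutive b , trans (m<n⇒m%n≡m (n<1+n n)) (suc-injective (sym (≡ᵇ-true⇒≡ e)))
  ... | false rewrite m<n⇒m%n≡m (suc<t j j<t e) =
        refl , trans (cong (_% t) (sym (+-suc j n))) (trans ([m+n]%n≡m%n j t) (m<n⇒m%n≡m j<t))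

  left-of-right : ∀ a j → j < t → left (twistR j a) (suc j % t) ≡ vtx a j
  left-of-right a j j<t = trans (cong (λ z → vtx z ((suc j % t) + n)) (proj₁ (twist-back j j<t a)))
    (vtx-cong a {(suc j % t) + n} {j} (trans (proj₂ (twist-back j j<t a)) (sym (m<n⇒m%n≡m j<t))))

  right-normal : ∀ a j → right a j ≡ vtx (twistR j a) (suc j % t)
  right-normal a j = vtx-cong (twistR j a) {suc j} {suc j % t} (sym (m%n%n≡m%n (suc j) t))

  twist-forth : ∀ a j → j < t → twistR ((j + n) % t) (twistL j a) ≡ a × suc ((j + n) % t) % t ≡ j
  twist-forth a zero j<t rewrite m<n⇒m%n≡m (n<1+n n) | ≡⇒≡ᵇ-true {n} {n} refl = swapUV-involutive a , n%n≡0 t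
  twist-forth a (suc j) j<t rewrite prev-column j j<t =
    twistR-inner j a (≢⇒≡ᵇ-false (λ e → <-irrefl e j<t)) , m<n⇒m%n≡m j<t

  left-normal : ∀ a j → left a j ≡ vtx (twistL j a) ((j + n) % t)
  left-normal a j = vtx-cong (twistL j a) {j + n} {(j + n) % t} (sym (m%n%n≡m%n (j + n) t))

  right-of-left : ∀ a j → j < t → right (twistL j a) ((j + n) % t) ≡ vtx a j
  right-of-left a j j<t = trans (right-normal (twistL j a) ((j + n) % t))
    (trans (cong (λ z → vtx z (suc ((j + n) % t) % t)) (proj₁ (twist-forth a j j<t)))
      (vtx-cong a {suc ((j + n) % t) % t} {j}
        (trans (m%n%n≡m%n (suc ((j + n) % t)) t) (trans (proj₂ (twist-forth a j j<t)) (sym (m<n⇒m%n≡m j<t))))))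

  spoke-arc : ∀ a k j → a ≢ 0F → arcℕ 0F k a j ≡ true → k ≡ j
  spoke-arc 0F k j nz _ = ⊥-elim (nz refl)
  spoke-arc (suc a) k j nz p = ≡ᵇ-true⇒≡ p

  right⇒left : ∀ b k a j → k < t → j < t → right b k ≡ vtx a j → vtx b k ≡ left a j
  right⇒left b k a j k<t j<t e = trans (sym (left-of-right b k k<t)) (cong₂ left same-layer same-column)
    where
    e' : vtx (twistR k b) (suc k % t) ≡ vtx a j
    e' = trans (sym (right-normal b k)) e
    same-layer : twistR k b ≡ a
    same-layer = vtx-injectiveˡ {twistR k b} {a} {suc k % t} {j} e'
    same-column : suc k % t ≡ j
    same-column = trans (sym (m%n%n≡m%n (suc k) t))
      (trans (vtx-injectiveʳ {twistR k b} {a} {suc k % t} {j} e') (m<n⇒m%n≡m j<t))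

  rim-neighbours-vtx : ∀ a j b k → a ≢ 0F → j < t → k < t → J t (vtx a j) (vtx b k) ≡ true →
    vtx b k ≡ hub j ⊎ vtx b k ≡ right a j ⊎ vtx b k ≡ left a j
  rim-neighbours-vtx a j b k nz j<t k<t p with ∨-elim {arcℕ a j b k} (trans (sym (J-vtx< a j b k j<t k<t)) p)
  ... | inj₁ q with rim-arc a b j k nz k<t q
  ... | refl , e = inj₂ (inj₁ (vtx-cong (twistR j a) {k} {suc j} (trans (m<n⇒m%n≡m k<t) (sym e))))
  rim-neighbours-vtx a j b k nz j<t k<t p | inj₂ q with b ≟ 0F
  ... | yes refl rewrite spoke-arc a k j nz q = inj₁ refl
  ... | no nzb with rim-arc b a k j nzb j<t q
  ... | refl , refl = inj₂ (inj₂ (sym (left-of-right b k k<t)))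

  rim-neighbours : ∀ a j y → a ≢ 0F → j < t → J t (vtx a j) y ≡ true →
    y ≡ hub j ⊎ y ≡ right a j ⊎ y ≡ left a j
  rim-neighbours a j y nz j<t p =
    subst (λ z → z ≡ hub j ⊎ z ≡ right a j ⊎ z ≡ left a j) (sym (vtx-coordinates y))
      (rim-neighbours-vtx a j (layer y) (column y) nz j<t (column<t y)
        (subst (λ z → J t (vtx a j) z ≡ true) (vtx-coordinates y) p))

  hub-neighbours : ∀ j y → j < t → J t (hub j) y ≡ true → y ≡ vtx 1F j ⊎ y ≡ vtx 2F j ⊎ y ≡ vtx 3F j
  hub-neighbours j y j<t p =
    subst (λ z → z ≡ vtx 1F j ⊎ z ≡ vtx 2F j ⊎ z ≡ vtx 3F j) (sym (vtx-coordinates y))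
      (by-layer (layer y) (trans (sym (J-vtx< 0F j (layer y) (column y) j<t (column<t y)))
        (subst (λ z → J t (hub j) z ≡ true) (vtx-coordinates y) p)))
    where
    k = column y
    by-layer : ∀ b → adjℕ 0F j b k ≡ true → vtx b k ≡ vtx 1F j ⊎ vtx b k ≡ vtx 2F j ⊎ vtx b k ≡ vtx 3F j
    by-layer 0F ()
    by-layer 1F q rewrite ≡ᵇ-true⇒≡ {j} {k} (trans (sym (∨-identityʳ _)) q) = inj₁ refl
    by-layer 2F q rewrite ≡ᵇ-true⇒≡ {j} {k} (trans (sym (∨-identityʳ _)) q) = inj₂ (inj₁ refl)
    by-layer 3F q rewrite ≡ᵇ-true⇒≡ {j} {k} (trans (sym (∨-identityʳ _)) q) = inj₂ (inj₂ refl)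

  J-spoke : ∀ a j → a ≢ 0F → J t (hub j) (vtx a j) ≡ true
  J-spoke 0F j nz = ⊥-elim (nz refl)
  J-spoke (suc a) j nz rewrite J-vtx 0F j (suc a) j = ∨-introˡ _ (≡⇒≡ᵇ-true {j % t} refl)

  J-right : ∀ a j → a ≢ 0F → j < t → J t (vtx a j) (right a j) ≡ true
  J-right a j nz j<t rewrite J-vtx a j (twistR j a) (suc j) | m<n⇒m%n≡m j<t = ∨-introˡ _ (arc-right a nz)
    where
    arc-right : ∀ a → a ≢ 0F → arcℕ a j (twistR j a) (suc j % t) ≡ true
    arc-right 0F nz = ⊥-elim (nz refl)
    arc-right 1F _ with j ≡ᵇ n in e
    ... | true rewrite wrap j e = ∧-intro e refl
    ... | false rewrite m<n⇒m%n≡m (suc<t j j<t e) = ≡⇒≡ᵇ-true {suc j} refl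
    arc-right 2F _ with j ≡ᵇ n in e
    ... | true rewrite wrap j e = ∧-intro e refl
    ... | false rewrite m<n⇒m%n≡m (suc<t j j<t e) = ≡⇒≡ᵇ-true {suc j} refl
    arc-right 3F _ with j ≡ᵇ n in e
    ... | true rewrite wrap j e = ∨-introʳ (suc j ≡ᵇ 0) (∧-intro e refl)
    ... | false rewrite m<n⇒m%n≡m (suc<t j j<t e) = ∨-introˡ _ (≡⇒≡ᵇ-true {suc j} refl)

  J-left : ∀ a j → a ≢ 0F → j < t → J t (vtx a j) (left a j) ≡ true
  J-left a j nz j<t =
    trans (cong (J t (vtx a j)) (left-normal a j))
    (trans (J-sym (vtx a j) (vtx (twistL j a) ((j + n) % t)))
    (subst (λ z → J t (vtx (twistL j a) ((j + n) % t)) z ≡ true) (right-of-left a j j<t)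
      (J-right (twistL j a) ((j + n) % t) (twistL-nonhub j a nz) (m%n<n (j + n) t))))

  hub≢right : ∀ a j → a ≢ 0F → hub j ≢ right a j
  hub≢right a j nz e = twistR-nonhub j a nz (sym (vtx-injectiveˡ {0F} {twistR j a} {j} {suc j} e))

  hub≢left : ∀ a j → a ≢ 0F → hub j ≢ left a j
  hub≢left a j nz e = twistL-nonhub j a nz (sym (vtx-injectiveˡ {0F} {twistL j a} {j} {j + n} e))

  right≢left : ∀ a j → 2 ≤ n → j < t → right a j ≢ left a j
  right≢left a j 2≤n j<t e = distinct-columns j j<t (vtx-injectiveʳ {twistR j a} {twistL j a} {suc j} {j + n} e)
    where
    distinct-columns : ∀ j → j < t → suc j % t ≡ (j + n) % t → ⊥
    distinct-columns zero j<t e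
      with trans (sym (m<n⇒m%n≡m {m = 1} (s≤s (≤-trans (n≤1+n 1) 2≤n)))) (trans e (m<n⇒m%n≡m (n<1+n n)))
    ... | e₁ = 2≰1 (subst (2 ≤_) (sym e₁) 2≤n)
    distinct-columns (suc j) j<t e with m≤n⇒m<n∨m≡n j<t
    ... | inj₁ ssj<t = <-irrefl (sym (trans (sym (m<n⇒m%n≡m ssj<t)) (trans e (prev-column j j<t))))
                          (≤-trans (n≤1+n (suc j)) ≤-refl)
    ... | inj₂ ssj≡t with trans (sym (trans (cong (_% t) ssj≡t) (n%n≡0 t))) (trans e (prev-column j j<t))
    ... | refl = 2≰1 (subst (2 ≤_) (sym (suc-injective ssj≡t)) 2≤n)

  hub-count : ∀ (f : V → Bool) j → j < t → (∀ y → f y ≡ true → J t (hub j) y ≡ true) →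
    count f ≡ ⟦ f (vtx 1F j) ⟧ + (⟦ f (vtx 2F j) ⟧ + ⟦ f (vtx 3F j) ⟧)
  hub-count f j j<t f⊆J = count-on-three f (vtx 1F j) (vtx 2F j) (vtx 3F j)
    (λ e → u≢v (vtx-injectiveˡ {1F} {2F} {j} {j} e)) (λ e → u≢w (vtx-injectiveˡ {1F} {3F} {j} {j} e))
    (λ e → v≢w (vtx-injectiveˡ {2F} {3F} {j} {j} e)) (λ y p → hub-neighbours j y j<t (f⊆J y p))
    where
    u≢v : _≢_ {A = Fin 4} 1F 2F
    u≢v ()
    u≢w : _≢_ {A = Fin 4} 1F 3F
    u≢w ()
    v≢w : _≢_ {A = Fin 4} 2F 3F
    v≢w ()

  rim-count : ∀ (f : V → Bool) a j → 2 ≤ n → a ≢ 0F → j < t → (∀ y → f y ≡ true → J t (vtx a j) y ≡ true) →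
    count f ≡ ⟦ f (hub j) ⟧ + (⟦ f (right a j) ⟧ + ⟦ f (left a j) ⟧)
  rim-count f a j 2≤n nz j<t f⊆J = count-on-three f (hub j) (right a j) (left a j)
    (hub≢right a j nz) (hub≢left a j nz) (right≢left a j 2≤n j<t) (λ y p → rim-neighbours a j y nz j<t (f⊆J y p))

  count-layer : ∀ (f : V → Bool) a → count {t} (λ j → f (combine a j)) ≡ sumBelow (λ j → ⟦ f (vtx a j) ⟧) t
  count-layer f a = count-toℕ (λ j → f (combine a j)) (λ j → f (vtx a j))
    (λ i → cong (λ z → f (combine a z)) (sym (mod-toℕ i)))

  count-by-columns : ∀ (f : V → Bool) →
    count f ≡ sumBelow (λ j → count4 (f (vtx 0F j)) (f (vtx 1F j)) (f (vtx 2F j)) (f (vtx 3F j))) t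
  count-by-columns f = begin
    count f
      ≡⟨ count-combine 4 t f ⟩
    L 0F + (L 1F + (L 2F + (L 3F + 0)))
      ≡⟨ cong (λ z → L 0F + (L 1F + (L 2F + z))) (+-identityʳ (L 3F)) ⟩
    L 0F + (L 1F + (L 2F + L 3F))
      ≡⟨ cong₂ _+_ (count-layer f 0F) (cong₂ _+_ (count-layer f 1F) (cong₂ _+_ (count-layer f 2F) (count-layer f 3F))) ⟩
    S 0F + (S 1F + (S 2F + S 3F))
      ≡⟨ cong (λ z → S 0F + (S 1F + z)) (sym (sumBelow-+ t (ind 2F) (ind 3F))) ⟩
    S 0F + (S 1F + sumBelow (λ j → ind 2F j + ind 3F j) t)
      ≡⟨ cong (S 0F +_) (sym (sumBelow-+ t (ind 1F) (λ j → ind 2F j + ind 3F j))) ⟩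
    S 0F + sumBelow (λ j → ind 1F j + (ind 2F j + ind 3F j)) t
      ≡⟨ sym (sumBelow-+ t (ind 0F) (λ j → ind 1F j + (ind 2F j + ind 3F j))) ⟩
    sumBelow (λ j → count4 (f (vtx 0F j)) (f (vtx 1F j)) (f (vtx 2F j)) (f (vtx 3F j))) t ∎
    where
    open ≡-Reasoning
    L : Fin 4 → ℕ
    L a = count {t} (λ j → f (combine a j))
    ind : Fin 4 → ℕ → ℕ
    ind a j = ⟦ f (vtx a j) ⟧
    S : Fin 4 → ℕ
    S a = sumBelow (ind a) t

-- (6) Every cycle of a 2-factor of J(t) is odd

par : ℕ → Bool
par zero = false
par (suc j) = not (par j)

par-even : ∀ K → par (K * 2) ≡ false
par-even zero = refl
par-even (suc K) = trans (not-involutive (par (K * 2))) (par-even K)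

last-column-even : ∀ n → suc n % 2 ≡ 1 → par n ≡ false
last-column-even n t-odd =
  subst (λ m → par m ≡ false)
    (sym (suc-injective (trans (m≡m%n+[m/n]*n (suc n) 2) (cong (_+ (suc n / 2) * 2) t-odd))))
    (par-even (suc n / 2))

exactlyTwo-of-sum : ∀ a b c → ⟦ a ⟧ + (⟦ b ⟧ + ⟦ c ⟧) ≡ 2 → exactlyTwo a b c ≡ true
exactlyTwo-of-sum true true true ()
exactlyTwo-of-sum true true false _ = refl
exactlyTwo-of-sum true false true _ = refl
exactlyTwo-of-sum true false false ()
exactlyTwo-of-sum false true true _ = refl
exactlyTwo-of-sum false true false ()
exactlyTwo-of-sum false false true ()
exactlyTwo-of-sum false false false ()

exactlyTwo-of-missing : ∀ a b c → missing a b c ≡ 1 → exactlyTwo a b c ≡ true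
exactlyTwo-of-missing true true true ()
exactlyTwo-of-missing true true false _ = refl
exactlyTwo-of-missing true false true _ = refl
exactlyTwo-of-missing true false false ()
exactlyTwo-of-missing false true true _ = refl
exactlyTwo-of-missing false true false ()
exactlyTwo-of-missing false false true ()
exactlyTwo-of-missing false false false ()

double≡2 : ∀ x → x + x ≡ 2 → x ≡ 1
double≡2 zero ()
double≡2 (suc zero) _ = refl
double≡2 (suc (suc x)) p with trans (sym (+-suc x (suc x))) (suc-injective (suc-injective p))
... | ()

≡ᵇ1-or-3 : ∀ {m} → ((m ≡ᵇ 1) ∨ (m ≡ᵇ 3)) ≡ true → m ≡ 1 ⊎ m ≡ 3
≡ᵇ1-or-3 {m} p with ∨-elim {m ≡ᵇ 1} p
... | inj₁ q = inj₁ (≡ᵇ-true⇒≡ q)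
... | inj₂ q = inj₂ (≡ᵇ-true⇒≡ q)

∨∧-elim : ∀ {c₁ c₂ c₃ r₁ r₂ r₃ : Bool} {P : Set} → ((c₁ ∧ r₁) ∨ (c₂ ∧ r₂) ∨ (c₃ ∧ r₃)) ≡ true →
  (c₁ ≡ true → r₁ ≡ true → P) → (c₂ ≡ true → r₂ ≡ true → P) → (c₃ ≡ true → r₃ ≡ true → P) → P
∨∧-elim {c₁} {c₂} {c₃} {r₁} {r₂} {r₃} p f g h with ∨-elim {c₁ ∧ r₁} p
... | inj₁ q = f (∧-elimˡ q) (∧-elimʳ {c₁} q)
... | inj₂ q with ∨-elim {c₂ ∧ r₂} q
... | inj₁ q' = g (∧-elimˡ q') (∧-elimʳ {c₂} q')
... | inj₂ q' = h (∧-elimˡ q') (∧-elimʳ {c₃} q')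

cong₃ : ∀ {A B C D : Set} (f : A → B → C → D) {a a' b b' c c'} → a ≡ a' → b ≡ b' → c ≡ c' → f a b c ≡ f a' b' c'
cong₃ f refl refl refl = refl

u≢h : _≢_ {A = Fin 4} 1F 0F
u≢h ()
v≢h : _≢_ {A = Fin 4} 2F 0F
v≢h ()
w≢h : _≢_ {A = Fin 4} 3F 0F
w≢h ()

module TwoFactor (n : ℕ) (2≤n : 2 ≤ n) (t-odd : suc n % 2 ≡ 1)
                 (F : Rel (4 * suc n)) (isF : IsTwoFactor (J (suc n)) F) where
  open FlowerSnark n

  F-sym : ∀ x y → F x y ≡ F y x
  F-sym = proj₁ isF
  F⊆J : ∀ x y → F x y ≡ true → J t x y ≡ true
  F⊆J = proj₁ (proj₂ isF)
  F-degree : ∀ x → degree F x ≡ 2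
  F-degree = proj₂ (proj₂ isF)

  spokeIn : Fin 4 → ℕ → Bool
  spokeIn a j = F (hub j) (vtx a j)
  rightIn : Fin 4 → ℕ → Bool
  rightIn a j = F (vtx a j) (right a j)
  leftIn : Fin 4 → ℕ → Bool
  leftIn a j = F (vtx a j) (left a j)

  rim-degree : ∀ a j → a ≢ 0F → j < t → ⟦ spokeIn a j ⟧ + (⟦ rightIn a j ⟧ + ⟦ leftIn a j ⟧) ≡ 2
  rim-degree a j nz j<t =
    trans (cong (λ x → ⟦ x ⟧ + (⟦ rightIn a j ⟧ + ⟦ leftIn a j ⟧)) (F-sym (hub j) (vtx a j)))
     (trans (sym (rim-count (F (vtx a j)) a j 2≤n nz j<t (F⊆J _))) (F-degree (vtx a j)))

  hub-degree : ∀ j → j < t → ⟦ spokeIn 1F j ⟧ + (⟦ spokeIn 2F j ⟧ + ⟦ spokeIn 3F j ⟧) ≡ 2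
  hub-degree j j<t = trans (sym (hub-count (F (hub j)) j j<t (F⊆J _))) (F-degree (hub j))

  degreesOK-at : ∀ j → j < t →
    degreesOK (spokeIn 1F j) (spokeIn 2F j) (spokeIn 3F j) (rightIn 1F j) (rightIn 2F j) (rightIn 3F j)
              (leftIn 1F j) (leftIn 2F j) (leftIn 3F j) ≡ true
  degreesOK-at j j<t =
    ∧-intro (exactlyTwo-of-sum (spokeIn 1F j) (spokeIn 2F j) (spokeIn 3F j) (hub-degree j j<t))
    (∧-intro (rim 1F u≢h) (∧-intro (rim 2F v≢h) (rim 3F w≢h)))
    where
    rim : ∀ a → a ≢ 0F → exactlyTwo (spokeIn a j) (rightIn a j) (leftIn a j) ≡ true
    rim a nz = exactlyTwo-of-sum (spokeIn a j) (rightIn a j) (leftIn a j) (rim-degree a j nz j<t)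

  missingR : ℕ → ℕ
  missingR j = missing (rightIn 1F j) (rightIn 2F j) (rightIn 3F j)
  missingL : ℕ → ℕ
  missingL j = missing (leftIn 1F j) (leftIn 2F j) (leftIn 3F j)

  missing-balance-at : ∀ j → j < t → missingR j + missingL j ≡ 2
  missing-balance-at j j<t = ≡ᵇ-true⇒≡ (⇒-elim (missing-balance
      (spokeIn 1F j) (spokeIn 2F j) (spokeIn 3F j) (rightIn 1F j) (rightIn 2F j) (rightIn 3F j)
      (leftIn 1F j) (leftIn 2F j) (leftIn 3F j)) (degreesOK-at j j<t))

  right≡left : ∀ a j → j < t → rightIn a j ≡ leftIn (twistR j a) (suc j % t)
  right≡left a j j<t =
    sym (trans (cong₂ F (sym (right-normal a j)) (left-of-right a j j<t)) (F-sym (right a j) (vtx a j)))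

  missingR-via-left : ∀ j → j < t →
    missingR j ≡ missing (leftIn (twistR j 1F) (suc j % t)) (leftIn (twistR j 2F) (suc j % t)) (leftIn (twistR j 3F) (suc j % t))
  missingR-via-left j j<t = cong₃ missing (right≡left 1F j j<t) (right≡left 2F j j<t) (right≡left 3F j j<t)

  -- Hence the missing left edges of column j + 1 are the missing right
  -- edges of column j (up to the twist u ↔ v, which does not change the
  -- count).
  missingL-next : ∀ j → j < t → missingL (suc j % t) ≡ missingR j
  missingL-next j j<t with bool-cases (suc j ≡ᵇ t)
  ... | inj₁ e = begin
    missing (leftIn 1F k) (leftIn 2F k) (leftIn 3F k)
      ≡⟨ x∙yz≈y∙xz ⟦ not (leftIn 1F k) ⟧ ⟦ not (leftIn 2F k) ⟧ ⟦ not (leftIn 3F k) ⟧ ⟩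
    missing (leftIn 2F k) (leftIn 1F k) (leftIn 3F k)
      ≡⟨ sym (cong₃ (λ a b c → missing (leftIn a k) (leftIn b k) (leftIn c k)) (twistR-last j 1F e) (twistR-last j 2F e) (twistR-w j)) ⟩
    missing (leftIn (twistR j 1F) k) (leftIn (twistR j 2F) k) (leftIn (twistR j 3F) k)
      ≡⟨ sym (missingR-via-left j j<t) ⟩
    missingR j ∎
    where
    open ≡-Reasoning
    k = suc j % t
  ... | inj₂ e = begin
    missing (leftIn 1F k) (leftIn 2F k) (leftIn 3F k)
      ≡⟨ sym (cong₃ (λ a b c → missing (leftIn a k) (leftIn b k) (leftIn c k)) (twistR-inner j 1F e) (twistR-inner j 2F e) (twistR-w j)) ⟩
    missing (leftIn (twistR j 1F) k) (leftIn (twistR j 2F) k) (leftIn (twistR j 3F) k)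
      ≡⟨ sym (missingR-via-left j j<t) ⟩
    missingR j ∎
    where
    open ≡-Reasoning
    k = suc j % t

  missing-step : ∀ j → suc j < t → missingR (suc j) + missingR j ≡ 2
  missing-step j sj<t =
    trans (cong (missingR (suc j) +_)
            (sym (trans (cong missingL (sym (m<n⇒m%n≡m sj<t))) (missingL-next j (<-trans (n<1+n j) sj<t)))))
          (missing-balance-at (suc j) sj<t)

  -- Consecutive columns have complementary counts of missing right edges,
  -- so the counts alternate along the columns 0, 1, …, t - 1.
  Alternation : ℕ → Set
  Alternation j = (par j ≡ false → missingR j ≡ missingR 0) × (par j ≡ true → missingR j + missingR 0 ≡ 2)

  alternation : ∀ j → j < t → Alternation j
  alternation zero _ = (λ _ → refl) , (λ ())
  alternation (suc j) sj<t with par j | alternation j (<-trans (n<1+n j) sj<t)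
  ... | true | (_ , odd-case) =
    (λ _ → +-cancelʳ-≡ (missingR j) (missingR (suc j)) (missingR 0)
             (trans (missing-step j sj<t) (sym (trans (+-comm (missingR 0) (missingR j)) (odd-case refl))))) ,
    (λ ())
  ... | false | (even-case , _) =
    (λ ()) ,
    (λ _ → trans (cong (missingR (suc j) +_) (sym (even-case refl))) (missing-step j sj<t))

  -- Closing the circle at the even column n = t - 1 gives one missing right
  -- edge in column 0, and then in every column.
  missingR-0 : missingR 0 ≡ 1
  missingR-0 = double≡2 (missingR 0)
    (trans (cong (missingR 0 +_) (sym (begin
      missingL 0           ≡⟨ cong missingL (sym (n%n≡0 t)) ⟩
      missingL (suc n % t) ≡⟨ missingL-next n ≤-refl ⟩
      missingR n           ≡⟨ proj₁ (alternation n (n<1+n n)) (last-column-even n t-odd) ⟩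
      missingR 0           ∎)))
    (missing-balance-at 0 (s≤s z≤n)))
    where open ≡-Reasoning

  missingR-one : ∀ j → j < t → missingR j ≡ 1
  missingR-one j j<t with par j | alternation j j<t
  ... | false | (even-case , _) = trans (even-case refl) missingR-0
  ... | true | (_ , odd-case) =
    +-cancelʳ-≡ (missingR 0) (missingR j) 1 (trans (odd-case refl) (cong (1 +_) (sym missingR-0)))

  missingL-one : ∀ j → j < t → missingL j ≡ 1
  missingL-one j j<t =
    +-cancelˡ-≡ 1 (missingL j) 1 (trans (cong (_+ missingL j) (sym (missingR-one j j<t))) (missing-balance-at j j<t))

  column0-even : ∀ j → not ((j ≡ᵇ 0) ∧ par j) ≡ true
  column0-even zero = refl
  column0-even (suc j) = refl

  columnOK-at : ∀ j → j < t →
    columnOK (spokeIn 1F j) (spokeIn 2F j) (spokeIn 3F j) (rightIn 1F j) (rightIn 2F j) (rightIn 3F j)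
             (leftIn 1F j) (leftIn 2F j) (leftIn 3F j) (par j) (j ≡ᵇ 0) ≡ true
  columnOK-at j j<t =
    ∧-intro (degreesOK-at j j<t)
    (∧-intro (exactlyTwo-of-missing (rightIn 1F j) (rightIn 2F j) (rightIn 3F j) (missingR-one j j<t))
    (∧-intro (exactlyTwo-of-missing (leftIn 1F j) (leftIn 2F j) (leftIn 3F j) (missingL-one j j<t))
             (column0-even j)))

  colourAt : Fin 4 → ℕ → Bool
  colourAt 0F j = hubColour (spokeIn 1F j) (spokeIn 2F j) (spokeIn 3F j) (rightIn 1F j) (rightIn 2F j) (rightIn 3F j) (par j)
  colourAt a j = rimColour a (rightIn 1F j) (rightIn 2F j) (rightIn 3F j) (leftIn 1F j) (leftIn 2F j) (leftIn 3F j) (par j) (j ≡ᵇ 0)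

  colour : V → Bool
  colour y = colourAt (layer y) (column y)

  colour-vtx : ∀ a j → j < t → colour (vtx a j) ≡ colourAt a j
  colour-vtx a j j<t = cong₂ colourAt (layer-vtx a j) (column-vtx< a j j<t)

  fromRight : Fin 4 → ℕ → Bool
  fromRight a j = colourFromRight a (rightIn 1F j) (rightIn 2F j) (rightIn 3F j) (par j)

  fromLeft : Fin 4 → ℕ → Bool
  fromLeft a j = colourFromLeft a (leftIn 1F j) (leftIn 2F j) (leftIn 3F j) (j ≡ᵇ 0) (prevParity (j ≡ᵇ 0) (par j))

  spoke-colour-column : ∀ j → j < t →
    ((spokeIn 1F j ⇒ iffB (colourAt 0F j) (colourAt 1F j)) ∧
     (spokeIn 2F j ⇒ iffB (colourAt 0F j) (colourAt 2F j)) ∧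
     (spokeIn 3F j ⇒ iffB (colourAt 0F j) (colourAt 3F j))) ≡ true
  spoke-colour-column j j<t = ⇒-elim (spoke-colour
    (spokeIn 1F j) (spokeIn 2F j) (spokeIn 3F j) (rightIn 1F j) (rightIn 2F j) (rightIn 3F j)
    (leftIn 1F j) (leftIn 2F j) (leftIn 3F j) (par j) (j ≡ᵇ 0)) (columnOK-at j j<t)

  two-sided-colour-column : ∀ j → j < t →
    (((leftIn 1F j ∧ rightIn 1F j) ⇒ iffB (fromRight 1F j) (fromLeft 1F j)) ∧
     ((leftIn 2F j ∧ rightIn 2F j) ⇒ iffB (fromRight 2F j) (fromLeft 2F j)) ∧
     ((leftIn 3F j ∧ rightIn 3F j) ⇒ iffB (fromRight 3F j) (fromLeft 3F j))) ≡ true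
  two-sided-colour-column j j<t = ⇒-elim (two-sided-colour
    (spokeIn 1F j) (spokeIn 2F j) (spokeIn 3F j) (rightIn 1F j) (rightIn 2F j) (rightIn 3F j)
    (leftIn 1F j) (leftIn 2F j) (leftIn 3F j) (par j) (j ≡ᵇ 0)) (columnOK-at j j<t)

  spoke-colour-at : ∀ a j → a ≢ 0F → j < t → spokeIn a j ≡ true → colourAt 0F j ≡ colourAt a j
  spoke-colour-at 0F j nz _ _ = ⊥-elim (nz refl)
  spoke-colour-at 1F j _ j<t s = iffB⇒≡ (⇒-elim (∧-elimˡ (spoke-colour-column j j<t)) s)
  spoke-colour-at 2F j _ j<t s = iffB⇒≡ (⇒-elim (∧-elimˡ (∧-elimʳ {spokeIn 1F j ⇒ _} (spoke-colour-column j j<t))) s)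
  spoke-colour-at 3F j _ j<t s =
    iffB⇒≡ (⇒-elim (∧-elimʳ {spokeIn 2F j ⇒ _} (∧-elimʳ {spokeIn 1F j ⇒ _} (spoke-colour-column j j<t))) s)

  two-sided-colour-at : ∀ b k → b ≢ 0F → k < t → leftIn b k ≡ true → rightIn b k ≡ true →
    fromRight b k ≡ fromLeft b k
  two-sided-colour-at 0F k nz _ _ _ = ⊥-elim (nz refl)
  two-sided-colour-at 1F k _ k<t l r = iffB⇒≡ (⇒-elim (∧-elimˡ (two-sided-colour-column k k<t)) (∧-intro l r))
  two-sided-colour-at 2F k _ k<t l r =
    iffB⇒≡ (⇒-elim (∧-elimˡ (∧-elimʳ {(leftIn 1F k ∧ rightIn 1F k) ⇒ _} (two-sided-colour-column k k<t))) (∧-intro l r))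
  two-sided-colour-at 3F k _ k<t l r =
    iffB⇒≡ (⇒-elim (∧-elimʳ {(leftIn 2F k ∧ rightIn 2F k) ⇒ _}
      (∧-elimʳ {(leftIn 1F k ∧ rightIn 1F k) ⇒ _} (two-sided-colour-column k k<t))) (∧-intro l r))

  colour-by-right : ∀ a j → a ≢ 0F → rightIn a j ≡ true →
    colourAt a j ≡ fromRight a j
  colour-by-right 0F j nz _ = ⊥-elim (nz refl)
  colour-by-right 1F j _ p rewrite p = refl
  colour-by-right 2F j _ p rewrite p = refl
  colour-by-right 3F j _ p rewrite p = refl

  colour-by-left : ∀ b k → b ≢ 0F → k < t → leftIn b k ≡ true →
    colourAt b k ≡ fromLeft b k
  colour-by-left b k nz k<t l with bool-cases (rightIn b k)
  ... | inj₁ r = trans (colour-by-right b k nz r) (two-sided-colour-at b k nz k<t l r)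
  ... | inj₂ r = right-missing b nz r
    where
    right-missing : ∀ b → b ≢ 0F → rightIn b k ≡ false →
      colourAt b k ≡ fromLeft b k
    right-missing 0F nz _ = ⊥-elim (nz refl)
    right-missing 1F _ p rewrite p = refl
    right-missing 2F _ p rewrite p = refl
    right-missing 3F _ p rewrite p = refl

  colour-across : ∀ a j → a ≢ 0F → j < t → fromLeft (twistR j a) (suc j % t) ≡ fromRight a j
  colour-across a j nz j<t with bool-cases (suc j ≡ᵇ t)
  ... | inj₁ e = colour-across-twisted a (twistR j a) _ _ _ _ (par k) _ _ _ _ nz (twistR-last j a e)
        (sym (trans (right≡left 2F j j<t) (cong (λ z → leftIn z k) (twistR-last j 2F e))))
        (sym (trans (right≡left 1F j j<t) (cong (λ z → leftIn z k) (twistR-last j 1F e))))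
        (sym (trans (right≡left 3F j j<t) (cong (λ z → leftIn z k) (twistR-w j))))
        (cong (_≡ᵇ 0) (wrap j e))
        (trans (cong par (suc-injective (≡ᵇ-true⇒≡ {suc j} {t} e))) (last-column-even n t-odd))
    where k = suc j % t
  ... | inj₂ e = colour-across-inner a (twistR j a) _ _ _ _ (par k) _ _ _ _ nz (twistR-inner j a e)
        (sym (trans (right≡left 1F j j<t) (cong (λ z → leftIn z k) (twistR-inner j 1F e))))
        (sym (trans (right≡left 2F j j<t) (cong (λ z → leftIn z k) (twistR-inner j 2F e))))
        (sym (trans (right≡left 3F j j<t) (cong (λ z → leftIn z k) (twistR-w j))))
        (cong (_≡ᵇ 0) (m<n⇒m%n≡m (suc<t j j<t e)))
        (cong par (m<n⇒m%n≡m (suc<t j j<t e)))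
    where k = suc j % t

  colour-right-edge : ∀ a j → a ≢ 0F → j < t → rightIn a j ≡ true → colourAt a j ≡ colour (right a j)
  colour-right-edge a j nz j<t p = begin
    colourAt a j           ≡⟨ colour-by-right a j nz p ⟩
    fromRight a j          ≡⟨ sym (colour-across a j nz j<t) ⟩
    fromLeft a' k          ≡⟨ sym (colour-by-left a' k (twistR-nonhub j a nz) k<t (trans (sym (right≡left a j j<t)) p)) ⟩
    colourAt a' k          ≡⟨ sym (colour-vtx a' k k<t) ⟩
    colour (vtx a' k)      ≡⟨ cong colour (sym (right-normal a j)) ⟩
    colour (right a j)     ∎
    where
    open ≡-Reasoning
    a' = twistR j a
    k = suc j % t
    k<t : k < t
    k<t = m%n<n (suc j) t

  colour-edge-vtx : ∀ a j z → j < t → F (vtx a j) z ≡ true → colourAt a j ≡ colour z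
  colour-edge-vtx 0F j z j<t p with hub-neighbours j z j<t (F⊆J _ _ p)
  ... | inj₁ refl = trans (spoke-colour-at 1F j u≢h j<t p) (sym (colour-vtx 1F j j<t))
  ... | inj₂ (inj₁ refl) = trans (spoke-colour-at 2F j v≢h j<t p) (sym (colour-vtx 2F j j<t))
  ... | inj₂ (inj₂ refl) = trans (spoke-colour-at 3F j w≢h j<t p) (sym (colour-vtx 3F j j<t))
  colour-edge-vtx a@(suc _) j z j<t p with rim-neighbours a j z (λ ()) j<t (F⊆J _ _ p)
  ... | inj₁ refl =
    trans (sym (spoke-colour-at a j (λ ()) j<t (trans (F-sym (hub j) (vtx a j)) p))) (sym (colour-vtx 0F j j<t))
  ... | inj₂ (inj₁ refl) = colour-right-edge a j (λ ()) j<t p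
  ... | inj₂ (inj₂ refl) = begin
    colourAt a j           ≡⟨ sym (colour-vtx a j j<t) ⟩
    colour (vtx a j)       ≡⟨ cong colour (sym (right-of-left a j j<t)) ⟩
    colour (right b i)     ≡⟨ sym (colour-right-edge b i (twistL-nonhub j a (λ ())) i<t left-edge) ⟩
    colourAt b i           ≡⟨ sym (colour-vtx b i i<t) ⟩
    colour (vtx b i)       ≡⟨ cong colour (sym (left-normal a j)) ⟩
    colour (left a j)      ∎
    where
    open ≡-Reasoning
    b = twistL j a
    i = (j + n) % t
    i<t : i < t
    i<t = m%n<n (j + n) t
    left-edge : rightIn b i ≡ true
    left-edge = trans (cong₂ F (sym (left-normal a j)) (right-of-left a j j<t)) (trans (F-sym (left a j) (vtx a j)) p)

  colour-edge : ∀ y z → F y z ≡ true → colour y ≡ colour z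
  colour-edge y z p =
    colour-edge-vtx (layer y) (column y) z (column<t y) (subst (λ w → F w z ≡ true) (vtx-coordinates y) p)

  module Cycle (x : V) where
    module Cx = Component F x

    -- Membership in the cycle, kept opaque so that type checking never
    -- unfolds the reachability computation.
    opaque
      inC : V → Bool
      inC y = sameComp F x y

    opaque
      unfolding inC
      inC-def : ∀ y → inC y ≡ sameComp F x y
      inC-def y = refl

    inC-closed : ∀ y z → inC y ≡ true → F y z ≡ true → inC z ≡ true
    inC-closed y z p q = trans (inC-def z) (Cx.comp-closed y z (trans (sym (inC-def y)) p) q)

    inC-colour : ∀ y → inC y ≡ true → colour y ≡ colour x
    inC-colour y p = Cx.comp-induction (λ y → colour y ≡ colour x) refl
      (λ y z py q → trans (sym (colour-edge y z q)) py) y (trans (sym (inC-def y)) p)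

    Meets : ℕ → Set
    Meets j = (inC (vtx 0F j) ∨ inC (vtx 1F j) ∨ inC (vtx 2F j) ∨ inC (vtx 3F j)) ≡ true

    meets-of : ∀ c k → inC (vtx c k) ≡ true → Meets k
    meets-of 0F k p = ∨-introˡ _ p
    meets-of 1F k p = ∨-introʳ (inC (vtx 0F k)) (∨-introˡ _ p)
    meets-of 2F k p = ∨-introʳ (inC (vtx 0F k)) (∨-introʳ (inC (vtx 1F k)) (∨-introˡ _ p))
    meets-of 3F k p = ∨-introʳ (inC (vtx 0F k)) (∨-introʳ (inC (vtx 1F k)) (∨-introʳ (inC (vtx 2F k)) p))

    slice : ℕ → ℕ
    slice j = count4 (inC (vtx 0F j)) (inC (vtx 1F j)) (inC (vtx 2F j)) (inC (vtx 3F j))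

    slice-at : ∀ j → j < t → Meets j →
      (((slice j ≡ᵇ 1) ∨ (slice j ≡ᵇ 3)) ∧
       ((inC (vtx 1F j) ∧ rightIn 1F j) ∨ (inC (vtx 2F j) ∧ rightIn 2F j) ∨ (inC (vtx 3F j) ∧ rightIn 3F j))) ≡ true
    slice-at j j<t meets = ⇒-elim (column-slice
        (spokeIn 1F j) (spokeIn 2F j) (spokeIn 3F j) (rightIn 1F j) (rightIn 2F j) (rightIn 3F j)
        (leftIn 1F j) (leftIn 2F j) (leftIn 3F j) (par j) (j ≡ᵇ 0)
        (colour x) (inC (vtx 0F j)) (inC (vtx 1F j)) (inC (vtx 2F j)) (inC (vtx 3F j)))
      (∧-intro (columnOK-at j j<t) (∧-intro (monochrome 0F) (∧-intro (monochrome 1F) (∧-intro (monochrome 2F)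
      (∧-intro (monochrome 3F) (∧-intro (out 1F) (∧-intro (out 2F) (∧-intro (out 3F)
      (∧-intro (back 1F) (∧-intro (back 2F) (∧-intro (back 3F) meets)))))))))))
      where
      monochrome : ∀ a → (inC (vtx a j) ⇒ iffB (colourAt a j) (colour x)) ≡ true
      monochrome a = ⇒-intro (λ q → ≡⇒iffB (trans (sym (colour-vtx a j j<t)) (inC-colour _ q)))
      out : ∀ a → (inC (vtx 0F j) ∧ spokeIn a j ⇒ inC (vtx a j)) ≡ true
      out a = ⇒-intro (λ q → inC-closed (hub j) (vtx a j) (∧-elimˡ q) (∧-elimʳ {inC (vtx 0F j)} q))
      back : ∀ a → (inC (vtx a j) ∧ spokeIn a j ⇒ inC (vtx 0F j)) ≡ true
      back a = ⇒-intro (λ q → inC-closed (vtx a j) (hub j) (∧-elimˡ q)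
        (trans (sym (F-sym (hub j) (vtx a j))) (∧-elimʳ {inC (vtx a j)} q)))

    -- Hence the cycle meets every column: it meets its own, and from each
    -- column it meets it continues to the next.
    meets-next : ∀ j → j < t → Meets j → Meets (suc j % t)
    meets-next j j<t meets = ∨∧-elim (∧-elimʳ (slice-at j j<t meets)) (via 1F) (via 2F) (via 3F)
      where
      via : ∀ a → inC (vtx a j) ≡ true → rightIn a j ≡ true → Meets (suc j % t)
      via a c r = meets-of (twistR j a) (suc j % t)
        (subst (λ w → inC w ≡ true) (right-normal a j) (inC-closed (vtx a j) (right a j) c r))

    meets-forward : ∀ j₀ → Meets j₀ → ∀ d → j₀ + d < t → Meets (j₀ + d)
    meets-forward j₀ m zero _ = subst Meets (sym (+-identityʳ j₀)) m
    meets-forward j₀ m (suc d) lt =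
      subst Meets (trans (m<n⇒m%n≡m lt') (sym (+-suc j₀ d)))
        (meets-next (j₀ + d) (<-trans (n<1+n _) lt') (meets-forward j₀ m d (<-trans (n<1+n _) lt')))
      where lt' : suc (j₀ + d) < t
            lt' = subst (_< t) (+-suc j₀ d) lt

    meets-own-column : Meets (column x)
    meets-own-column = meets-of (layer x) (column x)
      (subst (λ w → inC w ≡ true) (vtx-coordinates x) (trans (inC-def x) Cx.comp-refl))

    meets-every-column : ∀ j → j < t → Meets j
    meets-every-column j j<t = meets-forward 0 meets-first j j<t
      where
      column≤n : column x ≤ n
      column≤n = ≤-pred (column<t x)
      meets-last : Meets n
      meets-last = subst Meets (m+[n∸m]≡n column≤n)
        (meets-forward (column x) meets-own-column (n ∸ column x) (subst (_< t) (sym (m+[n∸m]≡n column≤n)) ≤-refl))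
      meets-first : Meets 0
      meets-first = subst Meets (n%n≡0 t) (meets-next n ≤-refl meets-last)

    slice-1-or-3 : ∀ j → j < t → slice j ≡ 1 ⊎ slice j ≡ 3
    slice-1-or-3 j j<t = ≡ᵇ1-or-3 {slice j} (∧-elimˡ {(slice j ≡ᵇ 1) ∨ (slice j ≡ᵇ 3)} (slice-at j j<t (meets-every-column j j<t)))

    cycleLength≡Σslice : cycleLength F x ≡ sumBelow slice t
    cycleLength≡Σslice = trans (count-ext (λ y → sym (inC-def y))) (count-by-columns inC)

    -- The length is t + 2K with t odd.
    cycle-odd : cycleLength F x % 2 ≡ 1
    cycle-odd = begin
      cycleLength F x % 2  ≡⟨ cong (_% 2) (trans cycleLength≡Σslice (proj₂ decomposition)) ⟩
      (t + K * 2) % 2      ≡⟨ [m+kn]%n≡m%n t K 2 ⟩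
      t % 2                ≡⟨ t-odd ⟩
      1                    ∎
      where
      open ≡-Reasoning
      decomposition : ∃ λ K → sumBelow slice t ≡ t + K * 2
      decomposition = sumBelow-odd-terms t slice slice-1-or-3
      K : ℕ
      K = proj₁ decomposition

-- (7) Two explicit 2-factors

∨-swap-pairs : ∀ a b c d → (a ∨ b ∨ c ∨ d) ≡ (b ∨ a ∨ d ∨ c)
∨-swap-pairs true true c d = refl
∨-swap-pairs true false true d = refl
∨-swap-pairs true false false true = refl
∨-swap-pairs true false false false = refl
∨-swap-pairs false true c d = refl
∨-swap-pairs false false true true = refl
∨-swap-pairs false false true false = refl
∨-swap-pairs false false false true = refl
∨-swap-pairs false false false false = refl

-- The spanning subgraph of J(t) obtained by deleting, in every column j, the
-- spoke from h_j to layer `deletedSpoke j` and the right rim edge of every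
-- rim vertex (a , j) with `deleteRight a j`.
module EdgeDeletion (n : ℕ) (2≤n : 2 ≤ n) (deletedSpoke : ℕ → Fin 4) (deleteRight : Fin 4 → ℕ → Bool)
                    (hub-keeps : ∀ i → deleteRight 0F i ≡ false) where
  open FlowerSnark n

  spokeDeleted : V → V → Bool
  spokeDeleted y z = (layer y == 0F) ∧ (z == vtx (deletedSpoke (column y)) (column y))

  rightDeleted : V → V → Bool
  rightDeleted y z = deleteRight (layer y) (column y) ∧ (z == right (layer y) (column y))

  deleted : V → V → Bool
  deleted y z = spokeDeleted y z ∨ spokeDeleted z y ∨ rightDeleted y z ∨ rightDeleted z y

  kept : Rel (4 * t)
  kept y z = J t y z ∧ not (deleted y z)

  kept-sym : ∀ y z → kept y z ≡ kept z y
  kept-sym y z = cong₂ (λ p q → p ∧ not q) (J-sym y z)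
    (∨-swap-pairs (spokeDeleted y z) (spokeDeleted z y) (rightDeleted y z) (rightDeleted z y))

  vtx==vtx : ∀ a b j → (vtx a j == vtx b j) ≡ (a == b)
  vtx==vtx a b j = true-iff⇒≡
    (λ p → subst (λ w → (a == w) ≡ true) (vtx-injectiveˡ {a} {b} {j} {j} (==⇒≡ p)) (==-refl a))
    (λ p → subst (λ w → (vtx a j == vtx w j) ≡ true) (==⇒≡ p) (==-refl _))

  spoke-deleted-rim : ∀ a j z → a ≢ 0F → spokeDeleted (vtx a j) z ≡ false
  spoke-deleted-rim a j z nz =
    cong (_∧ (z == vtx (deletedSpoke (column (vtx a j))) (column (vtx a j))))
         (≢⇒==-false (λ e → nz (trans (sym (layer-vtx a j)) e)))

  spoke-deleted-hub : ∀ a j → j < t → spokeDeleted (hub j) (vtx a j) ≡ (a == deletedSpoke j)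
  spoke-deleted-hub a j j<t =
    trans (cong (_∧ (vtx a j == vtx (deletedSpoke (column (hub j))) (column (hub j)))) (cong (_== 0F) (layer-vtx 0F j)))
    (trans (cong (λ i → vtx a j == vtx (deletedSpoke i) i) (column-vtx< 0F j j<t)) (vtx==vtx a (deletedSpoke j) j))

  right-deleted-hub : ∀ a j → j < t → rightDeleted (hub j) (vtx a j) ≡ false
  right-deleted-hub a j j<t =
    cong (_∧ (vtx a j == right (layer (hub j)) (column (hub j))))
         (trans (cong₂ deleteRight (layer-vtx 0F j) (column-vtx< 0F j j<t)) (hub-keeps j))

  right-deleted-to-hub : ∀ a j → a ≢ 0F → j < t → rightDeleted (vtx a j) (hub j) ≡ false
  right-deleted-to-hub a j nz j<t =
    trans (cong (deleteRight (layer (vtx a j)) (column (vtx a j)) ∧_)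
      (≢⇒==-false (λ e → hub≢right a j nz (trans e (cong₂ right (layer-vtx a j) (column-vtx< a j j<t))))))
    (∧-zeroʳ _)

  right-deleted-own : ∀ a j → j < t → rightDeleted (vtx a j) (right a j) ≡ deleteRight a j
  right-deleted-own a j j<t =
    trans (cong₂ _∧_ (cong₂ deleteRight (layer-vtx a j) (column-vtx< a j j<t))
      (subst (λ w → (right a j == w) ≡ true) (sym (cong₂ right (layer-vtx a j) (column-vtx< a j j<t))) (==-refl (right a j))))
    (∧-identityʳ (deleteRight a j))

  right-deleted-back : ∀ a j → a ≢ 0F → j < t → rightDeleted (right a j) (vtx a j) ≡ false
  right-deleted-back a j nz j<t = trans (cong (deleteRight (layer r) (column r) ∧_) (≢⇒==-false ne)) (∧-zeroʳ _)
    where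
    r = right a j
    ne : vtx a j ≢ right (layer r) (column r)
    ne e = right≢left a j 2≤n j<t
      (trans (vtx-coordinates r) (right⇒left (layer r) (column r) a j (column<t r) j<t (sym e)))

  right-deleted-left : ∀ a j → j < t → rightDeleted (vtx a j) (left a j) ≡ false
  right-deleted-left a j j<t =
    trans (cong (deleteRight (layer (vtx a j)) (column (vtx a j)) ∧_)
      (≢⇒==-false (λ e → right≢left a j 2≤n j<t (sym (trans e (cong₂ right (layer-vtx a j) (column-vtx< a j j<t)))))))
    (∧-zeroʳ _)

  right-deleted-of-left : ∀ a j → j < t → rightDeleted (left a j) (vtx a j) ≡ deleteRight (twistL j a) ((j + n) % t)
  right-deleted-of-left a j j<t =
    trans (cong₂ _∧_ (cong₂ deleteRight layer-left column-left)
      (subst (λ w → (vtx a j == w) ≡ true)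
        (sym (trans (cong₂ right layer-left column-left) (right-of-left a j j<t))) (==-refl (vtx a j))))
    (∧-identityʳ _)
    where
    layer-left : layer (left a j) ≡ twistL j a
    layer-left = layer-vtx (twistL j a) (j + n)
    column-left : column (left a j) ≡ (j + n) % t
    column-left = column-vtx (twistL j a) (j + n)

  kept-edge : ∀ y z v → J t y z ≡ true → deleted y z ≡ v → kept y z ≡ not v
  kept-edge y z v J-yz e rewrite J-yz = cong not e

  kept-spoke : ∀ a j → a ≢ 0F → j < t → kept (hub j) (vtx a j) ≡ not (a == deletedSpoke j)
  kept-spoke a j nz j<t = kept-edge (hub j) (vtx a j) (a == deletedSpoke j) (J-spoke a j nz) (begin
    deleted (hub j) (vtx a j)
      ≡⟨ cong₂ (λ p q → p ∨ q ∨ rightDeleted (hub j) (vtx a j) ∨ rightDeleted (vtx a j) (hub j))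
               (spoke-deleted-hub a j j<t) (spoke-deleted-rim a j (hub j) nz) ⟩
    (a == deletedSpoke j) ∨ false ∨ rightDeleted (hub j) (vtx a j) ∨ rightDeleted (vtx a j) (hub j)
      ≡⟨ cong₂ (λ p q → (a == deletedSpoke j) ∨ false ∨ p ∨ q) (right-deleted-hub a j j<t) (right-deleted-to-hub a j nz j<t) ⟩
    (a == deletedSpoke j) ∨ false ∨ false ∨ false
      ≡⟨ ∨-identityʳ _ ⟩
    (a == deletedSpoke j) ∎)
    where open ≡-Reasoning

  kept-right : ∀ a j → a ≢ 0F → j < t → kept (vtx a j) (right a j) ≡ not (deleteRight a j)
  kept-right a j nz j<t = kept-edge (vtx a j) (right a j) (deleteRight a j) (J-right a j nz j<t) (begin
    deleted (vtx a j) (right a j)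
      ≡⟨ cong₂ (λ p q → p ∨ q ∨ rightDeleted (vtx a j) (right a j) ∨ rightDeleted (right a j) (vtx a j))
               (spoke-deleted-rim a j (right a j) nz) (spoke-deleted-rim (twistR j a) (suc j) (vtx a j) (twistR-nonhub j a nz)) ⟩
    false ∨ false ∨ rightDeleted (vtx a j) (right a j) ∨ rightDeleted (right a j) (vtx a j)
      ≡⟨ cong₂ (λ p q → p ∨ q) (right-deleted-own a j j<t) (right-deleted-back a j nz j<t) ⟩
    deleteRight a j ∨ false
      ≡⟨ ∨-identityʳ _ ⟩
    deleteRight a j ∎)
    where open ≡-Reasoning

  kept-left : ∀ a j → a ≢ 0F → j < t → kept (vtx a j) (left a j) ≡ not (deleteRight (twistL j a) ((j + n) % t))
  kept-left a j nz j<t = kept-edge (vtx a j) (left a j) (deleteRight (twistL j a) ((j + n) % t)) (J-left a j nz j<t) (begin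
    deleted (vtx a j) (left a j)
      ≡⟨ cong₂ (λ p q → p ∨ q ∨ rightDeleted (vtx a j) (left a j) ∨ rightDeleted (left a j) (vtx a j))
               (spoke-deleted-rim a j (left a j) nz) (spoke-deleted-rim (twistL j a) (j + n) (vtx a j) (twistL-nonhub j a nz)) ⟩
    false ∨ false ∨ rightDeleted (vtx a j) (left a j) ∨ rightDeleted (left a j) (vtx a j)
      ≡⟨ cong₂ (λ p q → p ∨ q) (right-deleted-left a j j<t) (right-deleted-of-left a j j<t) ⟩
    deleteRight (twistL j a) ((j + n) % t) ∎)
    where open ≡-Reasoning

  -- The degree conditions: at each hub exactly one spoke is deleted, and
  -- each rim vertex loses exactly one of its spoke, right and left edge.
  module Degrees
    (hub-condition : ∀ j → j < t →
       ⟦ not (1F == deletedSpoke j) ⟧ + (⟦ not (2F == deletedSpoke j) ⟧ + ⟦ not (3F == deletedSpoke j) ⟧) ≡ 2)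
    (rim-condition : ∀ a j → a ≢ 0F → j < t →
       ⟦ not (a == deletedSpoke j) ⟧ + (⟦ not (deleteRight a j) ⟧ + ⟦ not (deleteRight (twistL j a) ((j + n) % t)) ⟧) ≡ 2)
    where

    kept-degree : ∀ a j → j < t → count (kept (vtx a j)) ≡ 2
    kept-degree 0F j j<t =
      trans (hub-count (kept (hub j)) j j<t (λ y p → ∧-elimˡ {J t (hub j) y} p))
      (trans (cong₂ (λ p q → ⟦ p ⟧ + q) (kept-spoke 1F j (λ ()) j<t)
         (cong₂ (λ p q → ⟦ p ⟧ + ⟦ q ⟧) (kept-spoke 2F j (λ ()) j<t) (kept-spoke 3F j (λ ()) j<t)))
       (hub-condition j j<t))
    kept-degree a@(suc _) j j<t =
      trans (rim-count (kept (vtx a j)) a j 2≤n nz j<t (λ y p → ∧-elimˡ {J t (vtx a j) y} p))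
      (trans (cong₂ (λ p q → ⟦ p ⟧ + q) (trans (kept-sym (vtx a j) (hub j)) (kept-spoke a j nz j<t))
         (cong₂ (λ p q → ⟦ p ⟧ + ⟦ q ⟧) (kept-right a j nz j<t) (kept-left a j nz j<t)))
       (rim-condition a j nz j<t))
      where
      nz : a ≢ 0F
      nz ()

    kept-isTwoFactor : IsTwoFactor (J t) kept
    kept-isTwoFactor = kept-sym , (λ y z p → ∧-elimˡ {J t y z} p) ,
      (λ y → subst (λ w → count (kept w) ≡ 2) (sym (vtx-coordinates y)) (kept-degree (layer y) (column y) (column<t y)))

-- F₁ deletes all spokes to w and alternately the right edges of u and v;
-- its w-rim is a cycle of length t.
F₁-spoke : ℕ → Fin 4
F₁-spoke _ = 3F

F₁-right : Fin 4 → ℕ → Bool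
F₁-right 1F i = not (par i)
F₁-right 2F i = par i
F₁-right _ _ = false

-- F₂ deletes the spokes to u in columns 0 and 1 and to w elsewhere; every
-- cycle of F₂ passes through three vertices of column 1 or of column 2.
F₂-spoke : ℕ → Fin 4
F₂-spoke 0 = 1F
F₂-spoke 1 = 1F
F₂-spoke (suc (suc _)) = 3F

F₂-right : Fin 4 → ℕ → Bool
F₂-right 1F i = not (par i) ∧ not (i ≡ᵇ 0)
F₂-right 2F i = par i
F₂-right 3F i = i ≡ᵇ 0
F₂-right _ _ = false

alternating-1 : ∀ p → 1 + (⟦ not (not (not p)) ⟧ + ⟦ not (not p) ⟧) ≡ 2
alternating-1 true = refl
alternating-1 false = refl

alternating-2 : ∀ p → 1 + (⟦ not (not p) ⟧ + ⟦ not p ⟧) ≡ 2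
alternating-2 true = refl
alternating-2 false = refl

alternating-3 : ∀ p → 1 + (⟦ not (not (not p) ∧ true) ⟧ + ⟦ not (not p ∧ true) ⟧) ≡ 2
alternating-3 true = refl
alternating-3 false = refl

slice-w-only : ∀ c₀ c₁ c₂ c₃ → c₀ ≡ false → c₁ ≡ false → c₂ ≡ false →
  (count4 c₀ c₁ c₂ c₃ ≡ 1 ⊎ count4 c₀ c₁ c₂ c₃ ≡ 3) → count4 c₀ c₁ c₂ c₃ ≡ 1
slice-w-only false false false true refl refl refl _ = refl
slice-w-only false false false false refl refl refl (inj₁ ())
slice-w-only false false false false refl refl refl (inj₂ ())

-- The local argument for F₂: a set meeting column 1, closed under the
-- spokes h₁v₁, h₁w₁, the rim edge u₁u₂ and the spoke u₂h₂ has at least two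
-- elements in column 1 or in column 2.
F₂-slices : Valid 8 (λ c_h₁ c_u₁ c_v₁ c_w₁ c_h₂ c_u₂ c_v₂ c_w₂ →
  ((c_h₁ ∨ c_u₁ ∨ c_v₁ ∨ c_w₁) ∧ (c_h₁ ⇒ c_v₁) ∧ (c_h₁ ⇒ c_w₁) ∧ (c_v₁ ⇒ c_h₁) ∧ (c_w₁ ⇒ c_h₁) ∧
   (c_u₁ ⇒ c_u₂) ∧ (c_u₂ ⇒ c_h₂)) ⇒
  ((1 <ᵇ count4 c_h₁ c_u₁ c_v₁ c_w₁) ∨ (1 <ᵇ count4 c_h₂ c_u₂ c_v₂ c_w₂)))
F₂-slices = allTrue-sound 8 _ refl

F₂-slices-≥2 : ∀ c_h₁ c_u₁ c_v₁ c_w₁ c_h₂ c_u₂ c_v₂ c_w₂ → (c_h₁ ∨ c_u₁ ∨ c_v₁ ∨ c_w₁) ≡ true →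
  (c_h₁ ≡ true → c_v₁ ≡ true) → (c_h₁ ≡ true → c_w₁ ≡ true) → (c_v₁ ≡ true → c_h₁ ≡ true) → (c_w₁ ≡ true → c_h₁ ≡ true) →
  (c_u₁ ≡ true → c_u₂ ≡ true) → (c_u₂ ≡ true → c_h₂ ≡ true) →
  2 ≤ count4 c_h₁ c_u₁ c_v₁ c_w₁ ⊎ 2 ≤ count4 c_h₂ c_u₂ c_v₂ c_w₂
F₂-slices-≥2 c_h₁ c_u₁ c_v₁ c_w₁ c_h₂ c_u₂ c_v₂ c_w₂ meets hv hw vh wh uu uh
  with ∨-elim {1 <ᵇ count4 c_h₁ c_u₁ c_v₁ c_w₁} (⇒-elim (F₂-slices c_h₁ c_u₁ c_v₁ c_w₁ c_h₂ c_u₂ c_v₂ c_w₂)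
    (∧-intro meets (∧-intro (⇒-intro hv) (∧-intro (⇒-intro hw) (∧-intro (⇒-intro vh)
      (∧-intro (⇒-intro wh) (∧-intro (⇒-intro uu) (⇒-intro uh))))))))
... | inj₁ q = inj₁ (<ᵇ⇒< 1 _ (subst T (sym q) tt))
... | inj₂ q = inj₂ (<ᵇ⇒< 1 _ (subst T (sym q) tt))

module ExplicitFactors (n : ℕ) (2≤n : 2 ≤ n) (t-odd : suc n % 2 ≡ 1) where
  open FlowerSnark n

  last-even : par n ≡ false
  last-even = last-column-even n t-odd

  n≢0 : (n ≡ᵇ 0) ≡ false
  n≢0 = ≢⇒≡ᵇ-false {n} {0} (λ { refl → 2≰1 (≤-trans 2≤n z≤n) })

  -- The rim condition of `EdgeDeletion.Degrees`, split into column 0 (whose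
  -- left neighbours lie in the twisted column n) and the other columns.
  rim-condition-by-cases : (A : ℕ → Fin 4) (cond : Fin 4 → ℕ → Bool) →
    (∀ a → a ≢ 0F → ⟦ not (a == A 0) ⟧ + (⟦ not (cond a 0) ⟧ + ⟦ not (cond (swapUV a) n) ⟧) ≡ 2) →
    (∀ a j → a ≢ 0F → suc j < t → ⟦ not (a == A (suc j)) ⟧ + (⟦ not (cond a (suc j)) ⟧ + ⟦ not (cond a j) ⟧) ≡ 2) →
    ∀ a j → a ≢ 0F → j < t → ⟦ not (a == A j) ⟧ + (⟦ not (cond a j) ⟧ + ⟦ not (cond (twistL j a) ((j + n) % t)) ⟧) ≡ 2
  rim-condition-by-cases A cond first next a zero nz _ =
    trans (cong (λ i → ⟦ not (a == A 0) ⟧ + (⟦ not (cond a 0) ⟧ + ⟦ not (cond (swapUV a) i) ⟧)) (m<n⇒m%n≡m (n<1+n n)))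
          (first a nz)
  rim-condition-by-cases A cond first next a (suc j) nz sj<t =
    trans (cong (λ i → ⟦ not (a == A (suc j)) ⟧ + (⟦ not (cond a (suc j)) ⟧ + ⟦ not (cond a i) ⟧)) (prev-column j sj<t))
          (next a j nz sj<t)

  module E₁ = EdgeDeletion n 2≤n F₁-spoke F₁-right (λ _ → refl)
  F₁ = E₁.kept

  F₁-isTwoFactor : IsTwoFactor (J t) F₁
  F₁-isTwoFactor = E₁.Degrees.kept-isTwoFactor (λ j _ → refl) (rim-condition-by-cases F₁-spoke F₁-right first next)
    where
    first : ∀ a → a ≢ 0F → ⟦ not (a == 3F) ⟧ + (⟦ not (F₁-right a 0) ⟧ + ⟦ not (F₁-right (swapUV a) n) ⟧) ≡ 2
    first 0F nz = ⊥-elim (nz refl)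
    first 1F _ = cong (λ p → 1 + (0 + ⟦ not p ⟧)) last-even
    first 2F _ = cong (λ p → 1 + (1 + ⟦ not (not p) ⟧)) last-even
    first 3F _ = refl
    next : ∀ a j → a ≢ 0F → suc j < t →
      ⟦ not (a == 3F) ⟧ + (⟦ not (F₁-right a (suc j)) ⟧ + ⟦ not (F₁-right a j) ⟧) ≡ 2
    next 0F j nz _ = ⊥-elim (nz refl)
    next 1F j _ _ = alternating-1 (par j)
    next 2F j _ _ = alternating-2 (par j)
    next 3F j _ _ = refl

  module E₂ = EdgeDeletion n 2≤n F₂-spoke F₂-right (λ _ → refl)
  F₂ = E₂.kept

  F₂-isTwoFactor : IsTwoFactor (J t) F₂
  F₂-isTwoFactor = E₂.Degrees.kept-isTwoFactor one-spoke (rim-condition-by-cases F₂-spoke F₂-right first next)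
    where
    one-spoke : ∀ j → j < t → ⟦ not (1F == F₂-spoke j) ⟧ + (⟦ not (2F == F₂-spoke j) ⟧ + ⟦ not (3F == F₂-spoke j) ⟧) ≡ 2
    one-spoke zero _ = refl
    one-spoke (suc zero) _ = refl
    one-spoke (suc (suc j)) _ = refl
    first : ∀ a → a ≢ 0F → ⟦ not (a == F₂-spoke 0) ⟧ + (⟦ not (F₂-right a 0) ⟧ + ⟦ not (F₂-right (swapUV a) n) ⟧) ≡ 2
    first 0F nz = ⊥-elim (nz refl)
    first 1F _ = cong (λ p → 0 + (1 + ⟦ not p ⟧)) last-even
    first 2F _ = cong₂ (λ p q → 1 + (1 + ⟦ not (not p ∧ not q) ⟧)) last-even n≢0
    first 3F _ = cong (λ q → 1 + (0 + ⟦ not q ⟧)) n≢0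
    next : ∀ a j → a ≢ 0F → suc j < t →
      ⟦ not (a == F₂-spoke (suc j)) ⟧ + (⟦ not (F₂-right a (suc j)) ⟧ + ⟦ not (F₂-right a j) ⟧) ≡ 2
    next 0F j nz _ = ⊥-elim (nz refl)
    next 1F zero _ _ = refl
    next 2F zero _ _ = refl
    next 3F zero _ _ = refl
    next 1F (suc j) _ _ = alternating-3 (not (par j))
    next 2F (suc j) _ _ = alternating-1 (par j)
    next 3F (suc j) _ _ = refl

  -- The cycle of F₁ through w₀ stays in layer w, so it meets each column
  -- in one vertex and has length t.
  module C₁ = TwoFactor.Cycle n 2≤n t-odd F₁ F₁-isTwoFactor (vtx 3F 0)

  F₁-w-closed : ∀ y z → layer y ≡ 3F → F₁ y z ≡ true → layer z ≡ 3F
  F₁-w-closed y z ly p = from-w (column y) z (column<t y)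
    (subst (λ w → F₁ w z ≡ true) (trans (vtx-coordinates y) (cong (λ a → vtx a (column y)) ly)) p)
    where
    from-w : ∀ j z → j < t → F₁ (vtx 3F j) z ≡ true → layer z ≡ 3F
    from-w j z j<t p with rim-neighbours 3F j z (λ ()) j<t (∧-elimˡ {J t (vtx 3F j) z} p)
    ... | inj₁ refl with () ← trans (sym p) (trans (E₁.kept-sym (vtx 3F j) (hub j)) (E₁.kept-spoke 3F j (λ ()) j<t))
    ... | inj₂ (inj₁ refl) = trans (layer-vtx (twistR j 3F) (suc j)) (twistR-w j)
    ... | inj₂ (inj₂ refl) = trans (layer-vtx (twistL j 3F) (j + n)) (twistL-w j)

  F₁-cycle-in-w : ∀ y → C₁.inC y ≡ true → layer y ≡ 3F
  F₁-cycle-in-w y p = Component.comp-induction F₁ (vtx 3F 0) (λ y → layer y ≡ 3F) (layer-vtx 3F 0) F₁-w-closed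
    y (trans (sym (C₁.inC-def y)) p)

  F₁-cycle-length : cycleLength F₁ (vtx 3F 0) ≡ t
  F₁-cycle-length = trans C₁.cycleLength≡Σslice (sumBelow-ones t C₁.slice (λ j j<t →
    slice-w-only (C₁.inC (vtx 0F j)) (C₁.inC (vtx 1F j)) (C₁.inC (vtx 2F j)) (C₁.inC (vtx 3F j))
      (off-w 0F j (λ ())) (off-w 1F j (λ ())) (off-w 2F j (λ ())) (C₁.slice-1-or-3 j j<t)))
    where
    off-w : ∀ a j → a ≢ 3F → C₁.inC (vtx a j) ≡ false
    off-w a j ne = not-true⇒false (λ p → ne (trans (sym (layer-vtx a j)) (F₁-cycle-in-w (vtx a j) p)))

  1<t : 1 < t
  1<t = s≤s (≤-trans (s≤s z≤n) 2≤n)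
  2<t : 2 < t
  2<t = s≤s 2≤n

  module _ (x : V) where
    module C₂ = TwoFactor.Cycle n 2≤n t-odd F₂ F₂-isTwoFactor x
    open C₂ using (inC; inC-closed)

    closed : ∀ y z → F₂ y z ≡ true → inC y ≡ true → inC z ≡ true
    closed y z e p = inC-closed y z p e

    spoke : ∀ a j → a ≢ 0F → j < t → a ≢ F₂-spoke j → F₂ (hub j) (vtx a j) ≡ true
    spoke a j nz j<t ne = trans (E₂.kept-spoke a j nz j<t) (cong not (≢⇒==-false ne))

    spoke-back : ∀ a j → a ≢ 0F → j < t → a ≢ F₂-spoke j → F₂ (vtx a j) (hub j) ≡ true
    spoke-back a j nz j<t ne = trans (E₂.kept-sym (vtx a j) (hub j)) (spoke a j nz j<t ne)

    u₁u₂ : F₂ (vtx 1F 1) (vtx 1F 2) ≡ true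
    u₁u₂ = subst (λ w → F₂ (vtx 1F 1) w ≡ true)
      (cong (λ a → vtx a 2) (twistR-inner 1 1F (≢⇒≡ᵇ-false {2} {t} (λ e → <-irrefl e 2<t))))
      (E₂.kept-right 1F 1 (λ ()) 1<t)

    F₂-cycle-long : t < cycleLength F₂ x
    F₂-cycle-long = subst (t <_) (sym C₂.cycleLength≡Σslice) (
      [ sumBelow-> t C₂.slice positive 1 1<t , sumBelow-> t C₂.slice positive 2 2<t ]′
      (F₂-slices-≥2 (inC (hub 1)) (inC (vtx 1F 1)) (inC (vtx 2F 1)) (inC (vtx 3F 1))
                    (inC (hub 2)) (inC (vtx 1F 2)) (inC (vtx 2F 2)) (inC (vtx 3F 2))
        (C₂.meets-every-column 1 1<t)
        (closed _ _ (spoke 2F 1 (λ ()) 1<t (λ ()))) (closed _ _ (spoke 3F 1 (λ ()) 1<t (λ ())))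
        (closed _ _ (spoke-back 2F 1 (λ ()) 1<t (λ ()))) (closed _ _ (spoke-back 3F 1 (λ ()) 1<t (λ ())))
        (closed _ _ u₁u₂) (closed _ _ (spoke-back 1F 2 (λ ()) 2<t (λ ())))))
      where
      positive : ∀ j → j < t → 1 ≤ C₂.slice j
      positive j j<t = [ (λ e → ≤-reflexive (sym e)) , (λ e → subst (1 ≤_) (sym e) (s≤s z≤n)) ]′ (C₂.slice-1-or-3 j j<t)

  -- F₁ and F₂ are not isomorphic: an isomorphism would carry the cycle of
  -- length t through w₀ to a cycle of F₂ of the same length.
  F₁≇F₂ : ¬ Isomorphic F₁ F₂
  F₁≇F₂ (σ , iso) = <-irrefl (sym (trans (sym (cycleLength-iso σ F₁ F₂ iso (vtx 3F 0))) F₁-cycle-length))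
    (F₂-cycle-long (Inverse.to σ (vtx 3F 0)))

odd≢even-mod4 : ∀ L c → L % 2 ≡ 1 → c % 2 ≡ 0 → (L % 4 ≡ᵇ c) ≡ false
odd≢even-mod4 L c L-odd c-even = ≢⇒≡ᵇ-false {L % 4} {c} λ e → 0≢1+n (begin
  0           ≡⟨ sym c-even ⟩
  c % 2       ≡⟨ cong (_% 2) (sym e) ⟩
  L % 4 % 2   ≡⟨ m∣n⇒o%n%m≡o%m 2 4 L (divides 2 refl) ⟩
  L % 2       ≡⟨ L-odd ⟩
  1           ∎)
  where open ≡-Reasoning

tPar-odd : ∀ {N} (F : Rel N) → (∀ x → cycleLength F x % 2 ≡ 1) → ∀ i → (2 * i) % 2 ≡ 0 → tPar F i ≡ 0
tPar-odd F all-odd i even = cong (_% 2) (count-none _ (λ x →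
  trans (cong (isRep F x ∧_) (odd≢even-mod4 (cycleLength F x) (2 * i) (all-odd x) even)) (∧-zeroʳ _)))

proposition4p2 : (t : ℕ) → t % 2 ≡ 1 → 5 ≤ t →
    OddTwoFactored (J t) ×
    StronglyPseudoTwoFactorIsomorphic (J t) ×
    ¬ TwoFactorIsomorphic (J t)
proposition4p2 (suc n) t-odd (s≤s 4≤n) = odd , (has-factor , same-parities) , not-isomorphic
  where
  2≤n : 2 ≤ n
  2≤n = ≤-trans (s≤s (s≤s z≤n)) 4≤n
  open ExplicitFactors n 2≤n t-odd

  odd : OddTwoFactored (J (suc n))
  odd F isF x = TwoFactor.Cycle.cycle-odd n 2≤n t-odd F isF x

  has-factor : HasTwoFactor (J (suc n))
  has-factor = F₁ , F₁-isTwoFactor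

  same-parities : ∀ F F' → IsTwoFactor (J (suc n)) F → IsTwoFactor (J (suc n)) F' →
    (tPar F 0 ≡ tPar F' 0) × (tPar F 1 ≡ tPar F' 1)
  same-parities F F' isF isF' =
    trans (tPar-odd F (odd F isF) 0 refl) (sym (tPar-odd F' (odd F' isF') 0 refl)) ,
    trans (tPar-odd F (odd F isF) 1 refl) (sym (tPar-odd F' (odd F' isF') 1 refl))

  not-isomorphic : ¬ TwoFactorIsomorphic (J (suc n))
  not-isomorphic (_ , all-isomorphic) = F₁≇F₂ (all-isomorphic F₁ F₂ F₁-isTwoFactor F₂-isTwoFactor)
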